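{- Let $n = 2k+1 \geq 3$ be odd. There exists a schedule for an asynchronous single round-robin tournament with $n$ teams that has guaranteed rest time $k-1$, games-played difference index $1$, and rest difference index $1$.
   Context: An asynchronous single round-robin tournament with $n$ teams is one in which every pair of distinct teams plays exactly once and no two games are simultaneous; a schedule is a linear ordering of the $\binom{n}{2}$ games. The guaranteed rest time of a schedule is the maximum integer $b$ such that any two games involving the same team are separated by at least $b$ games not involving that team. The games-played difference index is the minimum integer $p$ such that at every point in the schedule, the numbers of games played so far by any two teams differ by at most $p$. The rest difference index is the minimum integer $d$ such that for every game, if one of its teams has not played in $i_1$ consecutive games since its last game and the other in $i_2$ consecutive games since its last game, then $|i_1-i_2|\le d$; for a team playing its first game, all teams are deemed to have played in an imaginary game placed immediately before the first game of the schedule. -}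

module Defs where

open import Data.Nat using (ℕ; zero; suc; _≤_; ∣_-_∣)
open import Data.Fin using (Fin; _<_; _≟_)
open import Data.Bool using (Bool; true; false; if_then_else_; _∨_)
open import Data.Product using (_×_; _,_; Σ; proj₁; proj₂)
open import Data.List using (List; []; _∷_; _++_; reverse; length)
open import Data.List.Relation.Unary.All using (All)
open import Data.List.Relation.Unary.Any using (Any)
open import Data.List.Relation.Unary.Unique.Propositional using (Unique)
open import Data.List.Membership.Propositional using (_∈_)
open import Relation.Nullary using (¬_)
open import Relation.Nullary.Decidable using (⌊_⌋)
open import Relation.Binary.PropositionalEquality using (_≡_)

-- A game between teams i and j, stored as the ordered pair (i , j) with i < j.
Game : ℕ → Set
Game n = Fin n × Fin n

Schedule : ℕ → Set
Schedule n = List (Game n)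

plays : ∀ {n} → Fin n → Game n → Bool
plays x (i , j) = ⌊ x ≟ i ⌋ ∨ ⌊ x ≟ j ⌋

IsRoundRobin : ∀ n → Schedule n → Set
IsRoundRobin n S =
  All (λ g → proj₁ g < proj₂ g) S × Unique S ×
  (∀ (i j : Fin n) → i < j → (i , j) ∈ S)

played : ∀ {n} → Fin n → List (Game n) → ℕ
played x [] = 0
played x (g ∷ gs) = if plays x g then suc (played x gs) else played x gs

-- Length of the run of games not involving x at the head of a (reversed)
-- list, i.e. for a reversed prefix: the number of consecutive games
-- immediately before the current point that do not involve x.
idleRev : ∀ {n} → Fin n → List (Game n) → ℕ
idleRev x [] = 0
idleRev x (g ∷ gs) = if plays x g then 0 else suc (idleRev x gs)

-- If x has not played in `pre`, this is
-- length pre, i.e. the imaginary game placed before the schedule counts.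
idle : ∀ {n} → Fin n → List (Game n) → ℕ
idle x pre = idleRev x (reverse pre)

-- Any two games involving the same team are separated by at least b games
-- not involving that team (checked for consecutive games of a team, which
-- is equivalent).
RestAtLeast : ∀ {n} → Schedule n → ℕ → Set
RestAtLeast {n} S b =
  ∀ (pre : List (Game n)) (g : Game n) (post : List (Game n)) → S ≡ pre ++ g ∷ post →
  ∀ (x : Fin n) → plays x g ≡ true → Any (λ h → plays x h ≡ true) pre → b ≤ idle x pre

GuaranteedRestTime : ∀ {n} → Schedule n → ℕ → Set
GuaranteedRestTime S b = RestAtLeast S b × ¬ RestAtLeast S (suc b)

PlayedDiffAtMost : ∀ {n} → Schedule n → ℕ → Set
PlayedDiffAtMost {n} S p =
  ∀ (pre post : List (Game n)) → S ≡ pre ++ post →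
  ∀ (x y : Fin n) → ∣ played x pre - played y pre ∣ ≤ p

GamesPlayedDiffIndex : ∀ {n} → Schedule n → ℕ → Set
GamesPlayedDiffIndex S p =
  PlayedDiffAtMost S p × (∀ q → PlayedDiffAtMost S q → p ≤ q)

RestDiffAtMost : ∀ {n} → Schedule n → ℕ → Set
RestDiffAtMost {n} S d =
  ∀ (pre : List (Game n)) (i j : Fin n) (post : List (Game n)) →
  S ≡ pre ++ (i , j) ∷ post → ∣ idle i pre - idle j pre ∣ ≤ d

RestDiffIndex : ∀ {n} → Schedule n → ℕ → Set
RestDiffIndex S d =
  RestDiffAtMost S d × (∀ e → RestDiffAtMost S e → d ≤ e)

module Submission where

-- The teams are the residues 0,…,2k−1 modulo 2k together with
-- a team ∞ = 2k.  The schedule consists of k rounds of n games; round m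
-- (m < k) lists the edges of the Walecki Hamiltonian cycle
-- ∞, m, m+1, m−1, m+2, m−2, …, m+k, ∞ of K_n in the order
--   {∞,m}, {m+i, m−i} (0<i<k), {m+k,∞}, {m−(j−1), m+j} (0<j≤k),
-- and game i of round m is played at time m·n + i.
--
-- In round m every team plays exactly at two positions f < s with
-- f ≤ k and f + k ≤ s ≤ f + k + 1, and its first position f′ in round m+1
-- again satisfies f′ + k ≤ s ≤ f′ + k + 1 (team-positions,
-- positions-next-round).  Hence every wait between consecutive games of a
-- team lasts k−1 or k games, and a first game either happens at a time
-- t < k, after t idle games, or after k idle games (idle-at); this gives the
-- rest time and the rest difference.  Counting games, after i games of
-- round m every team has played 2m, 2m+1 or 2m+2 games, where 2m and 2m+2
-- never occur together (played-close).  Explicit games at the start of the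
-- schedule show that the three bounds are attained.  Finally a decoding map
-- from pairs to times inverts the schedule, so no game repeats, and every
-- pair is played in an explicitly given round (round-robin).

open import Defs
open import Data.Nat
open import Data.Nat.Properties
open import Data.Nat.DivMod
open import Data.Nat.Divisibility using (n∣m*n)
open import Data.Nat.Tactic.RingSolver using (solve-∀)
open import Data.Bool using (Bool; true; false; if_then_else_; _∨_)
open import Data.Bool.Properties using (∨-zeroʳ)
open import Data.Product using (Σ; _×_; _,_; proj₁; proj₂)
open import Data.Sum as Sum using (_⊎_; inj₁; inj₂)
open import Data.Empty using (⊥-elim)
open import Data.Fin as Fin using (Fin; toℕ; fromℕ<)
open import Data.Fin.Properties using (toℕ-fromℕ<; toℕ-injective; toℕ<n)
open import Data.List using (List; []; _∷_; _++_; length)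
open import Data.List.Properties using (∷-injective; ++-assoc; ++-identityʳ; reverse-++; length-++; ++-cancelˡ)
open import Data.List.Relation.Unary.All using (All; []; _∷_)
import Data.List.Relation.Unary.All.Properties as All
import Data.List.Relation.Unary.Any.Properties as Any
open import Data.List.Relation.Unary.Any using (Any; here)
open import Data.List.Relation.Unary.AllPairs using ([]; _∷_)
import Data.List.Relation.Unary.AllPairs.Properties as AllPairs
open import Data.List.Relation.Unary.Unique.Propositional using (Unique)
open import Data.List.Membership.Propositional using (_∈_; lose)
open import Data.List.Membership.Propositional.Properties using (∈-++⁺ˡ; ∈-++⁺ʳ)
open import Relation.Binary.PropositionalEquality
open import Relation.Nullary using (¬_; yes; no; Dec)
open import Relation.Nullary.Decidable using (⌊_⌋; dec-true; isYes≗does)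

∷ʳ-prefix : ∀ {A : Set} (xs ys zs : List A) (a b : A) →
            xs ++ a ∷ [] ≡ ys ++ b ∷ zs → Σ (List A) λ ws → xs ≡ ys ++ ws
∷ʳ-prefix xs [] zs a b eq = xs , refl
∷ʳ-prefix [] (y ∷ []) zs a b ()
∷ʳ-prefix [] (y ∷ y' ∷ ys) zs a b ()
∷ʳ-prefix (x ∷ xs) (y ∷ ys) zs a b eq with ∷-injective eq
... | refl , eq' with ∷ʳ-prefix xs ys zs a b eq'
... | ws , e = ws , cong (x ∷_) e

fromBool : Bool → ℕ
fromBool true = 1
fromBool false = 0

module Timeline {n : ℕ} (G : ℕ → Game n) where

  prefix : ℕ → List (Game n)
  prefix zero = []
  prefix (suc t) = prefix t ++ G t ∷ []

  segment : ℕ → ℕ → List (Game n)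
  segment l zero = []
  segment l (suc d) = G l ∷ segment (suc l) d

  length-prefix : ∀ t → length (prefix t) ≡ t
  length-prefix zero = refl
  length-prefix (suc t) = begin
      length (prefix t ++ G t ∷ []) ≡⟨ length-++ (prefix t) ⟩
      length (prefix t) + 1         ≡⟨ +-comm (length (prefix t)) 1 ⟩
      suc (length (prefix t))       ≡⟨ cong suc (length-prefix t) ⟩
      suc t                         ∎
    where open ≡-Reasoning

  prefix-+ : ∀ l d → prefix (l + d) ≡ prefix l ++ segment l d
  prefix-+ l zero = trans (cong prefix (+-identityʳ l)) (sym (++-identityʳ (prefix l)))
  prefix-+ l (suc d) = begin
      prefix (l + suc d)                     ≡⟨ cong prefix (+-suc l d) ⟩
      prefix (suc l + d)                     ≡⟨ prefix-+ (suc l) d ⟩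
      (prefix l ++ G l ∷ []) ++ segment (suc l) d ≡⟨ ++-assoc (prefix l) _ _ ⟩
      prefix l ++ segment l (suc d)          ∎
    where open ≡-Reasoning

  prefix-at : ∀ N t → t < N → prefix N ≡ prefix t ++ G t ∷ segment (suc t) (N ∸ suc t)
  prefix-at N t lt = trans (cong prefix (sym split)) (prefix-+ t (suc (N ∸ suc t)))
    where split : t + suc (N ∸ suc t) ≡ N
          split = trans (+-suc t _) (m+[n∸m]≡n lt)

  length-split : ∀ N pre post → prefix N ≡ pre ++ post → length pre + length post ≡ N
  length-split N pre post eq = trans (sym (length-++ pre)) (trans (cong length (sym eq)) (length-prefix N))

  prefix-of-prefix : ∀ N pre post → prefix N ≡ pre ++ post → pre ≡ prefix (length pre)
  prefix-of-prefix zero [] post eq = refl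
  prefix-of-prefix zero (x ∷ pre) post ()
  prefix-of-prefix (suc N) pre [] eq = trans (sym (++-identityʳ pre)) (trans (sym eq) (cong prefix (sym lenEq)))
    where
      lenEq : length pre ≡ suc N
      lenEq = trans (sym (+-identityʳ _)) (length-split (suc N) pre [] eq)
  prefix-of-prefix (suc N) pre (p ∷ post) eq with ∷ʳ-prefix (prefix N) pre post (G N) p eq
  ... | ws , e = prefix-of-prefix N pre ws e

  game-in-prefix : ∀ N pre g post → prefix N ≡ pre ++ g ∷ post →
                   pre ≡ prefix (length pre) × g ≡ G (length pre) × length pre < N
  game-in-prefix N pre g post eq = pre≡ , g≡ , l<N
    where
      l = length pre
      pre≡ = prefix-of-prefix N pre (g ∷ post) eq
      lenEq : l + suc (length post) ≡ N
      lenEq = length-split N pre (g ∷ post) eq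
      l<N : l < N
      l<N = subst (l <_) lenEq (m<m+n l z<s)
      both : prefix l ++ segment l (suc (length post)) ≡ prefix l ++ g ∷ post
      both = begin
          prefix l ++ segment l (suc (length post)) ≡⟨ sym (prefix-+ l _) ⟩
          prefix (l + suc (length post))            ≡⟨ cong prefix lenEq ⟩
          prefix N                                  ≡⟨ eq ⟩
          pre ++ g ∷ post                           ≡⟨ cong (_++ g ∷ post) pre≡ ⟩
          prefix l ++ g ∷ post                      ∎
        where open ≡-Reasoning
      g≡ : g ≡ G l
      g≡ = sym (proj₁ (∷-injective (++-cancelˡ (prefix l) _ _ both)))

  played-∷ʳ : ∀ (x : Fin n) (xs : List (Game n)) g →
              played x (xs ++ g ∷ []) ≡ played x xs + fromBool (plays x g)
  played-∷ʳ x [] g with plays x g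
  ... | true = refl
  ... | false = refl
  played-∷ʳ x (h ∷ xs) g with plays x h
  ... | true = cong suc (played-∷ʳ x xs g)
  ... | false = played-∷ʳ x xs g

  played-prefix-suc : ∀ x t → played x (prefix (suc t)) ≡ played x (prefix t) + fromBool (plays x (G t))
  played-prefix-suc x t = played-∷ʳ x (prefix t) (G t)

  idle-prefix-suc : ∀ x t → idle x (prefix (suc t)) ≡ (if plays x (G t) then 0 else suc (idle x (prefix t)))
  idle-prefix-suc x t rewrite reverse-++ (prefix t) (G t ∷ []) = refl

  played-before : ∀ x t → Any (λ h → plays x h ≡ true) (prefix t) → Σ ℕ λ u → u < t × plays x (G u) ≡ true
  played-before x zero ()
  played-before x (suc t) a with Any.++⁻ (prefix t) a
  ... | inj₁ a' with played-before x t a'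
  ... | u , lt , p = u , m<n⇒m<1+n lt , p
  played-before x (suc t) a | inj₂ (here p) = t , ≤-refl , p

  ∈-prefix : ∀ u N → u < N → G u ∈ prefix N
  ∈-prefix u (suc N) lt with m<1+n⇒m<n∨m≡n lt
  ... | inj₁ lt' = ∈-++⁺ˡ (∈-prefix u N lt')
  ... | inj₂ refl = ∈-++⁺ʳ (prefix N) (here refl)

  All-prefix : ∀ {P : Game n → Set} N → (∀ u → u < N → P (G u)) → All P (prefix N)
  All-prefix zero f = []
  All-prefix (suc N) f = All.++⁺ (All-prefix N (λ u lt → f u (m<n⇒m<1+n lt))) (f N ≤-refl ∷ [])

  Unique-prefix : ∀ N → (∀ u v → u < N → v < N → G u ≡ G v → u ≡ v) → Unique (prefix N)
  Unique-prefix zero inj = []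
  Unique-prefix (suc N) inj =
    AllPairs.++⁺ (Unique-prefix N (λ u v lu lv → inj u v (m<n⇒m<1+n lu) (m<n⇒m<1+n lv))) ([] ∷ [])
      (All-prefix N (λ u lt → (λ eq → <-irrefl (inj u N (m<n⇒m<1+n lt) ≤-refl eq) lt) ∷ []))

  idle-without-play : ∀ x t → (∀ u → u < t → plays x (G u) ≡ false) → idle x (prefix t) ≡ t
  idle-without-play x zero f = refl
  idle-without-play x (suc t) f rewrite idle-prefix-suc x t | f t ≤-refl =
    cong suc (idle-without-play x t (λ u lt → f u (m<n⇒m<1+n lt)))

  idle-after-play : ∀ x t₀ t → plays x (G t₀) ≡ true → t₀ < t →
                    (∀ u → t₀ < u → u < t → plays x (G u) ≡ false) → idle x (prefix t) + suc t₀ ≡ t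
  idle-after-play x t₀ (suc t) p lt f with m<1+n⇒m<n∨m≡n lt
  ... | inj₂ refl rewrite idle-prefix-suc x t₀ | p = refl
  ... | inj₁ lt' rewrite idle-prefix-suc x t | f t lt' ≤-refl =
    cong suc (idle-after-play x t₀ t p lt' (λ u l1 l2 → f u l1 (m<n⇒m<1+n l2)))

InPair : ℕ → ℕ × ℕ → Set
InPair x p = x ≡ proj₁ p ⊎ x ≡ proj₂ p

⌊x≟x⌋ : ∀ {n} (x : Fin n) → ⌊ x Fin.≟ x ⌋ ≡ true
⌊x≟x⌋ x = trans (isYes≗does (x Fin.≟ x)) (dec-true (x Fin.≟ x) refl)

plays-fst : ∀ {n} (i j : Fin n) → plays i (i , j) ≡ true
plays-fst i j = cong (_∨ ⌊ i Fin.≟ j ⌋) (⌊x≟x⌋ i)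

plays-snd : ∀ {n} (i j : Fin n) → plays j (i , j) ≡ true
plays-snd i j = trans (cong (⌊ j Fin.≟ i ⌋ ∨_) (⌊x≟x⌋ j)) (∨-zeroʳ _)

plays⇒≡ : ∀ {n} (x i j : Fin n) → plays x (i , j) ≡ true → x ≡ i ⊎ x ≡ j
plays⇒≡ x i j p with x Fin.≟ i | x Fin.≟ j
... | yes x≡i | _ = inj₁ x≡i
... | no _ | yes x≡j = inj₂ x≡j
... | no _ | no _ = ⊥-elim (false≢true p)
  where false≢true : false ≢ true
        false≢true ()

module Encoding (n : ℕ) .{{_ : NonZero n}} where

  -- Abstract, so that type checking never unfolds the proof inside fromℕ<.
  abstract
    team : ℕ → Fin n
    team a = fromℕ< (m%n<n a n)

    toℕ-team : ∀ {a} → a < n → toℕ (team a) ≡ a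
    toℕ-team {a} a<n = trans (toℕ-fromℕ< (m%n<n a n)) (m<n⇒m%n≡m a<n)

  team-toℕ : ∀ (x : Fin n) → team (toℕ x) ≡ x
  team-toℕ x = toℕ-injective (toℕ-team (toℕ<n x))

  game : ℕ × ℕ → Game n
  game (a , b) with a <? b
  ... | yes _ = team a , team b
  ... | no _ = team b , team a

  game-< : ∀ {a b} → a < b → game (a , b) ≡ (team a , team b)
  game-< {a} {b} a<b with a <? b
  ... | yes _ = refl
  ... | no a≮b = ⊥-elim (a≮b a<b)

  game-> : ∀ {a b} → b < a → game (a , b) ≡ (team b , team a)
  game-> {a} {b} b<a with a <? b
  ... | yes a<b = ⊥-elim (<-asym a<b b<a)
  ... | no _ = refl

  game-ordered : ∀ {a b} → a < n → b < n → a ≢ b → proj₁ (game (a , b)) Fin.< proj₂ (game (a , b))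
  game-ordered {a} {b} a<n b<n a≢b with a <? b
  ... | yes a<b rewrite toℕ-team a<n | toℕ-team b<n = a<b
  ... | no a≮b rewrite toℕ-team a<n | toℕ-team b<n = ≤∧≢⇒< (≮⇒≥ a≮b) (≢-sym a≢b)

  toℕ-≡team : ∀ {a} (x : Fin n) → a < n → x ≡ team a → toℕ x ≡ a
  toℕ-≡team x a<n refl = toℕ-team a<n

  plays-game⇒ : ∀ (x : Fin n) {a b} → a < n → b < n → plays x (game (a , b)) ≡ true → InPair (toℕ x) (a , b)
  plays-game⇒ x {a} {b} a<n b<n p with a <? b
  ... | yes _ = Sum.map (toℕ-≡team x a<n) (toℕ-≡team x b<n) (plays⇒≡ x (team a) (team b) p)
  ... | no _ = Sum.swap (Sum.map (toℕ-≡team x b<n) (toℕ-≡team x a<n) (plays⇒≡ x (team b) (team a) p))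

  plays-game⇐ : ∀ (x : Fin n) {a b} → a < n → b < n → InPair (toℕ x) (a , b) → plays x (game (a , b)) ≡ true
  plays-game⇐ x {a} {b} a<n b<n x∈ with a <? b | x∈
  ... | yes _ | inj₁ refl = subst (λ y → plays x (y , team b) ≡ true) (sym (team-toℕ x)) (plays-fst x _)
  ... | yes _ | inj₂ refl = subst (λ y → plays x (team a , y) ≡ true) (sym (team-toℕ x)) (plays-snd _ x)
  ... | no _ | inj₁ refl = subst (λ y → plays x (team b , y) ≡ true) (sym (team-toℕ x)) (plays-snd _ x)
  ... | no _ | inj₂ refl = subst (λ y → plays x (y , team a) ≡ true) (sym (team-toℕ x)) (plays-fst x _)

suc[j∸1] : ∀ j → 1 ≤ j → suc (j ∸ 1) ≡ j
suc[j∸1] (suc j) _ = refl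

module Rounds (k : ℕ) (k≥1 : 1 ≤ k) where

  n : ℕ
  n = 2 * k + 1

  -- 2k is both the modulus of the cycle of finite teams and the name of team ∞.
  2k : ℕ
  2k = 2 * k

  2k≡k+k : 2k ≡ k + k
  2k≡k+k = cong (k +_) (+-identityʳ k)

  k<2k : k < 2k
  k<2k = subst (k <_) (sym 2k≡k+k) (m<m+n k k≥1)

  2k<n : 2k < n
  2k<n = subst (2k <_) (+-comm 1 2k) ≤-refl

  2k∸k≡k : 2k ∸ k ≡ k
  2k∸k≡k = trans (cong (_∸ k) 2k≡k+k) (m+n∸m≡n k k)

  <2k⇒<n : ∀ {a} → a < 2k → a < n
  <2k⇒<n a<2k = <-trans a<2k 2k<n

  <n⇒≤2k : ∀ {a} → a < n → a ≤ 2k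
  <n⇒≤2k {a} a<n = ≤-pred (subst (a <_) (+-comm 2k 1) a<n)

  m+e<2k : ∀ m e → m < k → e ≤ k → m + e < 2k
  m+e<2k m e m<k e≤k = subst (m + e <_) (sym 2k≡k+k) (+-mono-<-≤ m<k e≤k)

  infixl 6 _⊖_
  _⊖_ : ℕ → ℕ → ℕ
  m ⊖ j with j ≤? m
  ... | yes _ = m ∸ j
  ... | no _ = m + 2k ∸ j

  ⊖-no-wrap : ∀ m j → j ≤ m → m ⊖ j + j ≡ m
  ⊖-no-wrap m j j≤m with j ≤? m
  ... | yes _ = m∸n+n≡m j≤m
  ... | no j≰m = ⊥-elim (j≰m j≤m)

  ⊖-wrap : ∀ m j → m < j → j ≤ m + 2k → m ⊖ j + j ≡ m + 2k
  ⊖-wrap m j m<j j≤m+2k with j ≤? m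
  ... | yes j≤m = ⊥-elim (<⇒≱ m<j j≤m)
  ... | no _ = m∸n+n≡m j≤m+2k

  ⊖-unwrapped : ∀ {m j z} → z + j ≡ m → m ⊖ j ≡ z
  ⊖-unwrapped {m} {j} {z} e = +-cancelʳ-≡ j _ z (trans (⊖-no-wrap m j j≤m) (sym e))
    where j≤m = subst (j ≤_) e (m≤n+m j z)

  ⊖-wrapped : ∀ {m j z} → m < j → z + j ≡ m + 2k → m ⊖ j ≡ z
  ⊖-wrapped {m} {j} {z} m<j e = +-cancelʳ-≡ j _ z (trans (⊖-wrap m j m<j j≤m+2k) (sym e))
    where j≤m+2k = subst (j ≤_) e (m≤n+m j z)

  ⊖-zero : ∀ m → m ⊖ 0 ≡ m
  ⊖-zero m = ⊖-unwrapped (+-identityʳ m)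

  suc⊖suc : ∀ m j → suc m ⊖ suc j ≡ m ⊖ j
  suc⊖suc m j with j ≤? m | suc j ≤? suc m
  ... | yes _ | yes _ = refl
  ... | no _ | no _ = refl
  ... | yes j≤m | no sj≰sm = ⊥-elim (sj≰sm (s≤s j≤m))
  ... | no j≰m | yes sj≤sm = ⊥-elim (j≰m (s≤s⁻¹ sj≤sm))

  ⊖<2k : ∀ m j → m < 2k → j ≤ 2k → m ⊖ j < 2k
  ⊖<2k m j m<2k j≤2k with j ≤? m
  ... | yes _ = ≤-<-trans (m∸n≤m m j) m<2k
  ... | no j≰m = subst (m + 2k ∸ j <_) (m+n∸m≡n m 2k)
                   (∸-monoʳ-< (≰⇒> j≰m) (≤-trans j≤2k (m≤n+m 2k m)))

  ⊖-involutive : ∀ m j → j < 2k → m ⊖ (m ⊖ j) ≡ j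
  ⊖-involutive m j j<2k with j ≤? m
  ... | yes j≤m = ⊖-unwrapped (m+[n∸m]≡n j≤m)
  ... | no j≰m = ⊖-wrapped m<m+2k∸j (m+[n∸m]≡n j≤m+2k)
    where
      j≤m+2k = ≤-trans (<⇒≤ j<2k) (m≤n+m 2k m)
      m<m+2k∸j : m < m + 2k ∸ j
      m<m+2k∸j = +-cancelʳ-< j m _ (subst (m + j <_) (sym (m∸n+n≡m j≤m+2k)) (+-monoʳ-< m j<2k))

  ⊖-ahead : ∀ m e → 1 ≤ e → e ≤ 2k → m ⊖ (m + e) ≡ 2k ∸ e
  ⊖-ahead m e 1≤e e≤2k = ⊖-wrapped (m<m+n m 1≤e) (begin
      2k ∸ e + (m + e) ≡⟨ cong (2k ∸ e +_) (+-comm m e) ⟩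
      2k ∸ e + (e + m) ≡⟨ sym (+-assoc (2k ∸ e) e m) ⟩
      2k ∸ e + e + m   ≡⟨ cong (_+ m) (m∸n+n≡m e≤2k) ⟩
      2k + m           ≡⟨ +-comm 2k m ⟩
      m + 2k           ∎)
    where open ≡-Reasoning

  -- Game i of round m: the Walecki cycle ∞, m, m+1, m−1, …, m+k, ∞ listed as
  -- {∞,m}, {m+i, m−i} (0<i<k), {m+k,∞}, {m−(j−1), m+j} (i = k+j, 0<j≤k).
  roundGame : ℕ → ℕ → ℕ × ℕ
  roundGame m i with k <? i | i ≟ k | i ≟ 0
  ... | yes _ | _ | _ = m ⊖ (i ∸ k ∸ 1) , m + (i ∸ k)
  ... | no _ | yes _ | _ = m + k , 2k
  ... | no _ | no _ | yes _ = 2k , m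
  ... | no _ | no _ | no _ = m + i , m ⊖ i

  roundGame-0 : ∀ m → roundGame m 0 ≡ (2k , m)
  roundGame-0 m with k <? 0 | 0 ≟ k
  ... | yes () | _
  ... | no _ | yes 0≡k = ⊥-elim (<⇒≢ k≥1 0≡k)
  ... | no _ | no _ = refl

  roundGame-mid : ∀ m i → 1 ≤ i → i < k → roundGame m i ≡ (m + i , m ⊖ i)
  roundGame-mid m i 1≤i i<k with k <? i | i ≟ k | i ≟ 0
  ... | yes k<i | _ | _ = ⊥-elim (<-asym k<i i<k)
  ... | no _ | yes refl | _ = ⊥-elim (<-irrefl refl i<k)
  ... | no _ | no _ | yes refl = ⊥-elim (<-irrefl refl 1≤i)
  ... | no _ | no _ | no _ = refl

  roundGame-k : ∀ m → roundGame m k ≡ (m + k , 2k)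
  roundGame-k m with k <? k | k ≟ k
  ... | yes k<k | _ = ⊥-elim (<-irrefl refl k<k)
  ... | no _ | yes _ = refl
  ... | no _ | no k≢k = ⊥-elim (k≢k refl)

  roundGame-late : ∀ m j → 1 ≤ j → roundGame m (k + j) ≡ (m ⊖ (j ∸ 1) , m + j)
  roundGame-late m j 1≤j with k <? k + j
  ... | yes _ = cong₂ _,_ (cong (λ d → m ⊖ (d ∸ 1)) (m+n∸m≡n k j)) (cong (m +_) (m+n∸m≡n k j))
  ... | no k≮k+j = ⊥-elim (k≮k+j (m<m+n k 1≤j))

  data PositionView : ℕ → Set where
    first-game  : PositionView 0
    middle-game : ∀ i → 1 ≤ i → i < k → PositionView i
    kth-game    : PositionView k
    late-game   : ∀ j → 1 ≤ j → j ≤ k → PositionView (k + j)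

  positionView : ∀ i → i < n → PositionView i
  positionView i i<n with i ≟ 0 | i <? k | i ≟ k
  ... | yes refl | _ | _ = first-game
  ... | no i≢0 | yes i<k | _ = middle-game i (n≢0⇒n>0 i≢0) i<k
  ... | no _ | no _ | yes refl = kth-game
  ... | no _ | no i≮k | no i≢k = subst PositionView (m+[n∸m]≡n k≤i) (late-game (i ∸ k) (m<n⇒0<n∸m k<i) i∸k≤k)
    where
      k≤i = ≮⇒≥ i≮k
      k<i = ≤∧≢⇒< k≤i (≢-sym i≢k)
      i∸k≤k = subst (i ∸ k ≤_) 2k∸k≡k (∸-monoˡ-≤ k (<n⇒≤2k i<n))

  -- The positions (first, second) at which a team plays in a round: a team
  -- e steps ahead of m plays at e and k+e, a team j steps behind m (or m
  -- itself, j = 0) at j and k+j+1, and ∞ at 0 and k.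
  upPositions : ℕ → ℕ × ℕ
  upPositions e = e , k + e

  downPositions : ℕ → ℕ × ℕ
  downPositions j = j , suc (k + j)

  -- A finite team x is classified by m ⊖ x, the number of steps it lies
  -- behind m: below k it is behind m, otherwise it is x − m ≤ k steps ahead.
  positions : ℕ → ℕ → ℕ × ℕ
  positions m x with x ≟ 2k | m ⊖ x <? k
  ... | yes _ | _ = 0 , k
  ... | no _ | yes _ = downPositions (m ⊖ x)
  ... | no _ | no _ = upPositions (x ∸ m)

  pos₁ : ℕ → ℕ → ℕ
  pos₁ m x = proj₁ (positions m x)

  pos₂ : ℕ → ℕ → ℕ
  pos₂ m x = proj₂ (positions m x)

  positions-∞ : ∀ m → positions m 2k ≡ (0 , k)
  positions-∞ m with 2k ≟ 2k
  ... | yes _ = refl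
  ... | no 2k≢2k = ⊥-elim (2k≢2k refl)

  positions-up : ∀ m e → m < k → 1 ≤ e → e ≤ k → positions m (m + e) ≡ upPositions e
  positions-up m e m<k 1≤e e≤k with m + e ≟ 2k | m ⊖ (m + e) <? k
  ... | yes m+e≡2k | _ = ⊥-elim (<⇒≢ (m+e<2k m e m<k e≤k) m+e≡2k)
  ... | no _ | no _ = cong upPositions (m+n∸m≡n m e)
  ... | no _ | yes behind = ⊥-elim (<⇒≱ behind k≤2k∸e)
    where
      k≤2k∸e : k ≤ m ⊖ (m + e)
      k≤2k∸e = subst (k ≤_) (sym (⊖-ahead m e 1≤e (≤-trans e≤k (<⇒≤ k<2k))))
                 (subst (_≤ 2k ∸ e) 2k∸k≡k (∸-monoʳ-≤ 2k e≤k))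

  positions-down : ∀ m j → m < k → j < k → positions m (m ⊖ j) ≡ downPositions j
  positions-down m j m<k j<k with m ⊖ j ≟ 2k | m ⊖ (m ⊖ j) <? k
  ... | yes eq | _ = ⊥-elim (<⇒≢ (⊖<2k m j (<-trans m<k k<2k) (<⇒≤ (<-trans j<k k<2k))) eq)
  ... | no _ | yes _ = cong downPositions (⊖-involutive m j (<-trans j<k k<2k))
  ... | no _ | no notBehind = ⊥-elim (notBehind (subst (_< k) (sym (⊖-involutive m j (<-trans j<k k<2k))) j<k))

  positions-self : ∀ m → m < k → positions m m ≡ downPositions 0
  positions-self m m<k = subst (λ x → positions m x ≡ downPositions 0) (⊖-zero m) (positions-down m 0 m<k k≥1)

  data TeamView (m : ℕ) : ℕ → Set where
    ∞-team : TeamView m 2k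
    ahead  : ∀ e → 1 ≤ e → e ≤ k → TeamView m (m + e)
    behind : ∀ j → j < k → TeamView m (m ⊖ j)

  teamView : ∀ m x → m < k → x < n → TeamView m x
  teamView m x m<k x<n with x ≟ 2k | m ⊖ x <? k
  ... | yes refl | _ = ∞-team
  ... | no x≢2k | yes d<k = subst (TeamView m) (⊖-involutive m x x<2k) (behind (m ⊖ x) d<k)
    where x<2k = ≤∧≢⇒< (<n⇒≤2k x<n) x≢2k
  ... | no x≢2k | no d≮k = subst (TeamView m) (m+[n∸m]≡n (<⇒≤ m<x)) (ahead (x ∸ m) (m<n⇒0<n∸m m<x) x∸m≤k)
    where
      x<2k = ≤∧≢⇒< (<n⇒≤2k x<n) x≢2k
      k≤d = ≮⇒≥ d≮k
      m<x : m < x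
      m<x = ≰⇒> λ x≤m → d≮k (≤-<-trans (subst (_≤ m) (sym (⊖-unwrapped (m∸n+n≡m x≤m))) (m∸n≤m m x)) m<k)
      x∸m≤k : x ∸ m ≤ k
      x∸m≤k = +-cancelˡ-≤ (m ⊖ x) (x ∸ m) k (begin
        m ⊖ x + (x ∸ m)        ≡⟨ cong (_+ (x ∸ m)) m⊖x≡ ⟩
        2k ∸ (x ∸ m) + (x ∸ m) ≡⟨ m∸n+n≡m (≤-trans (m∸n≤m x m) (<⇒≤ x<2k)) ⟩
        2k                     ≡⟨ 2k≡k+k ⟩
        k + k                  ≤⟨ +-monoˡ-≤ k k≤d ⟩
        m ⊖ x + k              ∎)
        where
          open ≤-Reasoning
          m⊖x≡ : m ⊖ x ≡ 2k ∸ (x ∸ m)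
          m⊖x≡ = trans (cong (m ⊖_) (sym (m+[n∸m]≡n (<⇒≤ m<x))))
                   (⊖-ahead m (x ∸ m) (m<n⇒0<n∸m m<x) (≤-trans (m∸n≤m x m) (<⇒≤ x<2k)))

  inGame⇒atPosition : ∀ m i x → m < k → i < n → InPair x (roundGame m i) → i ≡ pos₁ m x ⊎ i ≡ pos₂ m x
  inGame⇒atPosition m i x m<k i<n x∈ with positionView i i<n
  ... | first-game with subst (InPair x) (roundGame-0 m) x∈
  ...   | inj₁ refl = inj₁ (sym (cong proj₁ (positions-∞ m)))
  ...   | inj₂ refl = inj₁ (sym (cong proj₁ (positions-self m m<k)))
  inGame⇒atPosition m i x m<k i<n x∈ | middle-game i 1≤i i<k with subst (InPair x) (roundGame-mid m i 1≤i i<k) x∈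
  ...   | inj₁ refl = inj₁ (sym (cong proj₁ (positions-up m i m<k 1≤i (<⇒≤ i<k))))
  ...   | inj₂ refl = inj₁ (sym (cong proj₁ (positions-down m i m<k i<k)))
  inGame⇒atPosition m i x m<k i<n x∈ | kth-game with subst (InPair x) (roundGame-k m) x∈
  ...   | inj₁ refl = inj₁ (sym (cong proj₁ (positions-up m k m<k k≥1 ≤-refl)))
  ...   | inj₂ refl = inj₂ (sym (cong proj₂ (positions-∞ m)))
  inGame⇒atPosition m i x m<k i<n x∈ | late-game j 1≤j j≤k with subst (InPair x) (roundGame-late m j 1≤j) x∈
  ...   | inj₁ refl = inj₂ (sym (trans (cong proj₂ (positions-down m (j ∸ 1) m<k j∸1<k))
                                      (trans (sym (+-suc k (j ∸ 1))) (cong (k +_) (suc[j∸1] j 1≤j)))))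
    where j∸1<k = <-≤-trans (subst (j ∸ 1 <_) (suc[j∸1] j 1≤j) ≤-refl) j≤k
  ...   | inj₂ refl = inj₂ (sym (cong proj₂ (positions-up m j m<k 1≤j j≤k)))

  record Spread (p : ℕ × ℕ) : Set where
    constructor spread
    field
      first≤k   : proj₁ p ≤ k
      gap≥k     : proj₁ p + k ≤ proj₂ p
      gap≤k+1   : proj₂ p ≤ suc (proj₁ p + k)
      second≤2k : proj₂ p ≤ 2k

  record TeamPositions (m x : ℕ) : Set where
    constructor teamPositions
    field
      plays-first  : InPair x (roundGame m (pos₁ m x))
      plays-second : InPair x (roundGame m (pos₂ m x))
      spread-ok    : Spread (positions m x)

  team-positions : ∀ m x → m < k → x < n → TeamPositions m x
  team-positions m x m<k x<n = byView (teamView m x m<k x<n)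
    where
      from : ∀ {x f s} → positions m x ≡ (f , s) →
             InPair x (roundGame m f) → InPair x (roundGame m s) → Spread (f , s) → TeamPositions m x
      from {x} eq a b c = teamPositions (subst (λ p → InPair x (roundGame m (proj₁ p))) (sym eq) a)
                                        (subst (λ p → InPair x (roundGame m (proj₂ p))) (sym eq) b)
                                        (subst Spread (sym eq) c)
      byView : ∀ {x} → TeamView m x → TeamPositions m x
      byView ∞-team = from (positions-∞ m) (inj₁ (sym (cong proj₁ (roundGame-0 m))))
                           (inj₂ (sym (cong proj₂ (roundGame-k m))))
                           (spread z≤n ≤-refl (n≤1+n k) (<⇒≤ k<2k))
      byView (ahead e 1≤e e≤k) = from (positions-up m e m<k 1≤e e≤k) (inj₁ first)
                                      (inj₂ (sym (cong proj₂ (roundGame-late m e 1≤e))))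
                                      (spread e≤k (≤-reflexive (+-comm e k)) (≤-trans (≤-reflexive (+-comm k e)) (n≤1+n _))
                                              (subst (k + e ≤_) (sym 2k≡k+k) (+-monoʳ-≤ k e≤k)))
        where
          first : m + e ≡ proj₁ (roundGame m e)
          first with m≤n⇒m<n∨m≡n e≤k
          ... | inj₁ e<k = sym (cong proj₁ (roundGame-mid m e 1≤e e<k))
          ... | inj₂ refl = sym (cong proj₁ (roundGame-k m))
      byView (behind j j<k) = from (positions-down m j m<k j<k) (inj₂ (first j j<k))
                                   (inj₁ (sym (trans (cong (λ i → proj₁ (roundGame m i)) (sym (+-suc k j)))
                                                     (cong proj₁ (roundGame-late m (suc j) (s≤s z≤n))))))
                                   (spread (<⇒≤ j<k) (≤-trans (≤-reflexive (+-comm j k)) (n≤1+n _))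
                                           (s≤s (≤-reflexive (+-comm k j)))
                                           (subst (suc (k + j) ≤_) (sym 2k≡k+k) (+-monoʳ-< k j<k)))
        where
          first : ∀ j → j < k → m ⊖ j ≡ proj₂ (roundGame m j)
          first zero _ = trans (⊖-zero m) (sym (cong proj₂ (roundGame-0 m)))
          first (suc j) j<k = sym (cong proj₂ (roundGame-mid m (suc j) (s≤s z≤n) j<k))

  Consecutive : ℕ × ℕ → ℕ × ℕ → Set
  Consecutive p q = proj₁ q + k ≤ proj₂ p × proj₂ p ≤ suc (proj₁ q + k)

  positions-next-round : ∀ m x → suc m < k → x < n → Consecutive (positions m x) (positions (suc m) x)
  positions-next-round m x sm<k x<n = byView (teamView (suc m) x sm<k x<n)
    where
      m<k = <-trans (n<1+n m) sm<k
      from : ∀ {x f s f′ s′} → positions m x ≡ (f , s) → positions (suc m) x ≡ (f′ , s′) →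
             f′ + k ≤ s → s ≤ suc (f′ + k) → Consecutive (positions m x) (positions (suc m) x)
      from eq eq′ lo hi = subst₂ Consecutive (sym eq) (sym eq′) (lo , hi)
      byView : ∀ {x} → TeamView (suc m) x → Consecutive (positions m x) (positions (suc m) x)
      byView ∞-team = from (positions-∞ m) (positions-∞ (suc m)) ≤-refl (n≤1+n k)
      byView (ahead e 1≤e e≤k) with m≤n⇒m<n∨m≡n e≤k
      ... | inj₁ e<k = from (trans (cong (positions m) (sym (+-suc m e))) (positions-up m (suc e) m<k (s≤s z≤n) e<k))
                            (positions-up (suc m) e sm<k 1≤e e≤k)
                            (≤-trans (≤-reflexive (+-comm e k)) (+-monoʳ-≤ k (n≤1+n e)))
                            (≤-reflexive (trans (+-suc k e) (cong suc (+-comm k e))))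
      ... | inj₂ refl = from (trans (cong (positions m) (sym wraps)) (positions-down m j m<k j<k))
                             (positions-up (suc m) k sm<k k≥1 ≤-refl)
                             (≤-reflexive (sym s≡k+k)) (≤-trans (≤-reflexive s≡k+k) (n≤1+n _))
        where
          j = k ∸ 1
          sj≡k = suc[j∸1] k k≥1
          j<k : j < k
          j<k = subst (j <_) sj≡k ≤-refl
          s≡k+k : suc (k + j) ≡ k + k
          s≡k+k = trans (sym (+-suc k j)) (cong (k +_) sj≡k)
          -- team (m+1)+k, the last team ahead of m+1, is k−1 steps behind m
          wraps : m ⊖ j ≡ suc m + k
          wraps = ⊖-wrapped (≤-pred (subst (suc m <_) (sym sj≡k) sm<k)) (begin
              suc m + k + j   ≡⟨ cong suc (+-assoc m k j) ⟩
              suc (m + (k + j)) ≡⟨ sym (+-suc m (k + j)) ⟩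
              m + suc (k + j) ≡⟨ cong (m +_) s≡k+k ⟩
              m + (k + k)     ≡⟨ cong (m +_) (sym 2k≡k+k) ⟩
              m + 2k          ∎)
            where open ≡-Reasoning
      byView (behind zero 0<k) = from (trans (cong (positions m) (trans (⊖-zero (suc m)) (+-comm 1 m))) (positions-up m 1 m<k ≤-refl (≤-trans (s≤s z≤n) sm<k)))
                                     (positions-down (suc m) 0 sm<k 0<k)
                                     (m≤m+n k 1) (≤-reflexive (+-comm k 1))
      byView (behind (suc j) sj<k) = from (trans (cong (positions m) (suc⊖suc m j)) (positions-down m j m<k (<-trans (n<1+n j) sj<k)))
                                          (positions-down (suc m) (suc j) sm<k sj<k)
                                          (≤-reflexive (cong suc (+-comm j k)))
                                          (s≤s (≤-trans (≤-reflexive (+-comm k j)) (n≤1+n _)))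

  ValidPair : ℕ × ℕ → Set
  ValidPair p = proj₁ p < n × proj₂ p < n × proj₁ p ≢ proj₂ p

  roundGame-valid : ∀ m i → m < k → i < n → ValidPair (roundGame m i)
  roundGame-valid m i m<k i<n with positionView i i<n
  ... | first-game rewrite roundGame-0 m = 2k<n , <2k⇒<n m<2k , >⇒≢ m<2k
    where m<2k = <-trans m<k k<2k
  ... | middle-game i 1≤i i<k rewrite roundGame-mid m i 1≤i i<k =
        <2k⇒<n (m+e<2k m i m<k (<⇒≤ i<k)) , <2k⇒<n (⊖<2k m i (<-trans m<k k<2k) (<⇒≤ (<-trans i<k k<2k))) , differ
    where
      -- the second positions of m + i and m ⊖ i are k+i and k+i+1
      differ : m + i ≢ m ⊖ i
      differ eq = m≢1+m+n (k + i) {0} (trans (sym (cong proj₂ (positions-up m i m<k 1≤i (<⇒≤ i<k))))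
                    (trans (cong (pos₂ m) eq) (trans (cong proj₂ (positions-down m i m<k i<k)) (cong suc (sym (+-identityʳ _))))))
  ... | kth-game rewrite roundGame-k m = <2k⇒<n (m+e<2k m k m<k ≤-refl) , 2k<n , <⇒≢ (m+e<2k m k m<k ≤-refl)
  ... | late-game j 1≤j j≤k rewrite roundGame-late m j 1≤j =
        <2k⇒<n (⊖<2k m (j ∸ 1) (<-trans m<k k<2k) (≤-trans (<⇒≤ j∸1<k) (<⇒≤ k<2k))) , <2k⇒<n (m+e<2k m j m<k j≤k) , differ
    where
      j∸1<k = <-≤-trans (subst (j ∸ 1 <_) (suc[j∸1] j 1≤j) ≤-refl) j≤k
      -- the first positions of m ⊖ (j − 1) and m + j are j − 1 and j
      differ : m ⊖ (j ∸ 1) ≢ m + j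
      differ eq = 1+n≢n (trans (suc[j∸1] j 1≤j) (sym (trans (sym (cong proj₁ (positions-down m (j ∸ 1) m<k j∸1<k)))
                    (trans (cong (pos₁ m) eq) (cong proj₁ (positions-up m j m<k 1≤j j≤k))))))

module WaleckiSchedule (k : ℕ) (k≥1 : 1 ≤ k) where

  open Rounds k k≥1 public

  instance
    n-nonZero : NonZero n
    n-nonZero = >-nonZero (≤-<-trans z≤n 2k<n)

  open Encoding n public

  -- The number of games, k·n = n(n−1)/2.
  N : ℕ
  N = k * n

  -- G is kept abstract: it is only ever used through G-at, and unfolding the
  -- division in its definition makes type checking needlessly expensive.
  abstract
    G : ℕ → Game n
    G t = game (roundGame (t / n) (t % n))

    G-at : ∀ m i → i < n → G (m * n + i) ≡ game (roundGame m i)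
    G-at m i i<n = cong₂ (λ m′ i′ → game (roundGame m′ i′)) quotient remainder
      where
        open ≡-Reasoning
        remainder : (m * n + i) % n ≡ i
        remainder = begin
          (m * n + i) % n ≡⟨ cong (_% n) (+-comm (m * n) i) ⟩
          (i + m * n) % n ≡⟨ [m+kn]%n≡m%n i m n ⟩
          i % n           ≡⟨ m<n⇒m%n≡m i<n ⟩
          i               ∎
        quotient : (m * n + i) / n ≡ m
        quotient = begin
          (m * n + i) / n   ≡⟨ +-distrib-/-∣ˡ i (n∣m*n m) ⟩
          m * n / n + i / n ≡⟨ cong₂ _+_ (m*n/n≡m m n) (m<n⇒m/n≡0 i<n) ⟩
          m + 0             ≡⟨ +-identityʳ m ⟩
          m                 ∎

  open Timeline G public

  walecki : Schedule n
  walecki = prefix N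

  decompose : ∀ t → Σ ℕ λ m → Σ ℕ λ i → i < n × t ≡ m * n + i
  decompose t = t / n , t % n , m%n<n t n , trans (m≡m%n+[m/n]*n t n) (+-comm (t % n) _)

  round<k : ∀ m i → m * n + i < N → m < k
  round<k m i t<N = ≰⇒> λ k≤m → <⇒≱ t<N (≤-trans (*-monoˡ-≤ n k≤m) (m≤m+n (m * n) i))

  time<N : ∀ m i → m < k → i < n → m * n + i < N
  time<N m i m<k i<n = <-≤-trans (+-monoʳ-< (m * n) i<n) (subst (_≤ N) (+-comm n (m * n)) (*-monoˡ-≤ n m<k))

  first second : ℕ → Fin n → ℕ
  first m x = pos₁ m (toℕ x)
  second m x = pos₂ m (toℕ x)

  positionsOf : ∀ m (x : Fin n) → m < k → TeamPositions m (toℕ x)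
  positionsOf m x m<k = team-positions m (toℕ x) m<k (toℕ<n x)

  spreadOf : ∀ m (x : Fin n) → m < k → Spread (positions m (toℕ x))
  spreadOf m x m<k = TeamPositions.spread-ok (positionsOf m x m<k)

  first<second : ∀ m (x : Fin n) → m < k → first m x < second m x
  first<second m x m<k = <-≤-trans (m<m+n _ k≥1) (Spread.gap≥k (spreadOf m x m<k))

  second<n : ∀ m (x : Fin n) → m < k → second m x < n
  second<n m x m<k = ≤-<-trans (Spread.second≤2k (spreadOf m x m<k)) 2k<n

  first<n : ∀ m (x : Fin n) → m < k → first m x < n
  first<n m x m<k = <-trans (first<second m x m<k) (second<n m x m<k)

  plays-at⇒ : ∀ m i (x : Fin n) → m < k → i < n → plays x (G (m * n + i)) ≡ true → i ≡ first m x ⊎ i ≡ second m x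
  plays-at⇒ m i x m<k i<n p with roundGame-valid m i m<k i<n
  ... | a<n , b<n , _ = inGame⇒atPosition m i (toℕ x) m<k i<n (plays-game⇒ x a<n b<n (trans (cong (plays x) (sym (G-at m i i<n))) p))

  plays-at⇐ : ∀ m i (x : Fin n) → m < k → i < n → InPair (toℕ x) (roundGame m i) → plays x (G (m * n + i)) ≡ true
  plays-at⇐ m i x m<k i<n x∈ with roundGame-valid m i m<k i<n
  ... | a<n , b<n , _ = trans (cong (plays x) (G-at m i i<n)) (plays-game⇐ x a<n b<n x∈)

  plays-first : ∀ m (x : Fin n) → m < k → plays x (G (m * n + first m x)) ≡ true
  plays-first m x m<k = plays-at⇐ m _ x m<k (first<n m x m<k) (TeamPositions.plays-first (positionsOf m x m<k))

  plays-second : ∀ m (x : Fin n) → m < k → plays x (G (m * n + second m x)) ≡ true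
  plays-second m x m<k = plays-at⇐ m _ x m<k (second<n m x m<k) (TeamPositions.plays-second (positionsOf m x m<k))

  rests-at : ∀ m i (x : Fin n) → m < k → i < n → i ≢ first m x → i ≢ second m x → plays x (G (m * n + i)) ≡ false
  rests-at m i x m<k i<n i≢f i≢s with plays x (G (m * n + i)) in eq
  ... | false = refl
  ... | true with plays-at⇒ m i x m<k i<n eq
  ...   | inj₁ e = ⊥-elim (i≢f e)
  ...   | inj₂ e = ⊥-elim (i≢s e)

  rests-between : ∀ m (x : Fin n) a b u → m < k → m * n + a ≤ u → u < m * n + b → b ≤ n →
                  (∀ i → a ≤ i → i < b → i ≢ first m x × i ≢ second m x) → plays x (G u) ≡ false
  rests-between m x a b u m<k lo hi b≤n avoids =
      subst (λ t → plays x (G t) ≡ false) u≡ (rests-at m i x m<k i<n (proj₁ (avoids i a≤i i<b)) (proj₂ (avoids i a≤i i<b)))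
    where
      i = u ∸ m * n
      u≡ : m * n + i ≡ u
      u≡ = m+[n∸m]≡n (≤-trans (m≤m+n (m * n) a) lo)
      a≤i : a ≤ i
      a≤i = +-cancelˡ-≤ (m * n) a i (subst (m * n + a ≤_) (sym u≡) lo)
      i<b : i < b
      i<b = +-cancelˡ-< (m * n) i b (subst (_< m * n + b) (sym u≡) hi)
      i<n : i < n
      i<n = <-≤-trans i<b b≤n

module Rests (k : ℕ) (k≥1 : 1 ≤ k) where

  open WaleckiSchedule k k≥1

  NearK : ℕ → Set
  NearK d = k ≤ suc d × d ≤ k

  near-within-round : ∀ d f s → d + suc f ≡ s → f + k ≤ s → s ≤ suc (f + k) → NearK d
  near-within-round d f s e lo hi =
      +-cancelˡ-≤ f k (suc d) (subst (f + k ≤_) s≡ lo) ,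
      ≤-pred (+-cancelˡ-≤ f (suc d) (suc k) (subst₂ _≤_ s≡ (sym (+-suc f k)) hi))
    where
      s≡ : s ≡ f + suc d
      s≡ = trans (sym e) (swap d f)
        where swap : ∀ d f → d + suc f ≡ f + suc d
              swap = solve-∀

  near-across-rounds : ∀ d f s → d + s ≡ 2k + f → f + k ≤ s → s ≤ suc (f + k) → NearK d
  near-across-rounds d f s e lo hi = lower , upper
    where
      open ≤-Reasoning
      d+s≡ : d + s ≡ k + (f + k)
      d+s≡ = trans e (trans (cong (_+ f) 2k≡k+k) (rearrange k f))
        where rearrange : ∀ a b → (a + a) + b ≡ a + (b + a)
              rearrange = solve-∀
      lower : k ≤ suc d
      lower = +-cancelʳ-≤ (f + k) k (suc d) (begin
          k + (f + k)     ≡⟨ sym d+s≡ ⟩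
          d + s           ≤⟨ +-monoʳ-≤ d hi ⟩
          d + suc (f + k) ≡⟨ +-suc d (f + k) ⟩
          suc d + (f + k) ∎)
      upper : d ≤ k
      upper = +-cancelʳ-≤ (f + k) d k (begin
          d + (f + k) ≤⟨ +-monoʳ-≤ d lo ⟩
          d + s       ≡⟨ d+s≡ ⟩
          k + (f + k) ∎)

  data IdleAt (x : Fin n) (t : ℕ) : Set where
    first-game : t < k → idle x (prefix t) ≡ t → (∀ u → u < t → plays x (G u) ≡ false) → IdleAt x t
    later-game : k ≤ t → NearK (idle x (prefix t)) → IdleAt x t

  idle-round-0 : ∀ (x : Fin n) → IdleAt x (first 0 x)
  idle-round-0 x = byCase (f <? k)
    where
      f = first 0 x
      earlier : ∀ u → u < f → plays x (G u) ≡ false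
      earlier u u<f = rests-between 0 x 0 f u k≥1 z≤n u<f (<⇒≤ (first<n 0 x k≥1))
                        (λ i _ i<f → <⇒≢ i<f , <⇒≢ (<-trans i<f (first<second 0 x k≥1)))
      idle≡f : idle x (prefix f) ≡ f
      idle≡f = idle-without-play x f earlier
      byCase : Dec (f < k) → IdleAt x f
      byCase (yes f<k) = first-game f<k idle≡f earlier
      byCase (no f≮k) = later-game (≮⇒≥ f≮k)
        (subst NearK (sym idle≡f) (≤-trans (≮⇒≥ f≮k) (n≤1+n _) , Spread.first≤k (spreadOf 0 x k≥1)))

  idle-second : ∀ m (x : Fin n) → m < k → IdleAt x (m * n + second m x)
  idle-second m x m<k = later-game k≤t (near-within-round d f s d+f+1≡s (Spread.gap≥k sp) (Spread.gap≤k+1 sp))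
    where
      f = first m x
      s = second m x
      sp = spreadOf m x m<k
      d = idle x (prefix (m * n + s))
      k≤t : k ≤ m * n + s
      k≤t = ≤-trans (≤-trans (m≤n+m k f) (Spread.gap≥k sp)) (m≤n+m s (m * n))
      between : ∀ u → m * n + f < u → u < m * n + s → plays x (G u) ≡ false
      between u lo hi = rests-between m x (suc f) s u m<k (subst (_≤ u) (sym (+-suc (m * n) f)) lo) hi (<⇒≤ (second<n m x m<k))
                          (λ i f<i i<s → >⇒≢ f<i , <⇒≢ i<s)
      d+f+1≡s : d + suc f ≡ s
      d+f+1≡s = +-cancelˡ-≡ (m * n) _ _ (trans (shuffle d (m * n) f)
                   (idle-after-play x (m * n + f) (m * n + s) (plays-first m x m<k) (+-monoʳ-< (m * n) (first<second m x m<k)) between))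
        where shuffle : ∀ d a f → a + (d + suc f) ≡ d + suc (a + f)
              shuffle = solve-∀

  idle-next-round : ∀ m (x : Fin n) → suc m < k → IdleAt x (suc m * n + first (suc m) x)
  idle-next-round m x sm<k = later-game k≤t (near-across-rounds d f s d+s≡ (proj₁ consecutive) (proj₂ consecutive))
    where
      m<k = <-trans (n<1+n m) sm<k
      f = first (suc m) x
      s = second m x
      t = suc m * n + f
      t₀ = m * n + s
      d = idle x (prefix t)
      consecutive = positions-next-round m (toℕ x) sm<k (toℕ<n x)
      k≤t : k ≤ t
      k≤t = ≤-trans (<⇒≤ (<-trans k<2k 2k<n)) (≤-trans (m≤m+n n (m * n)) (m≤m+n (suc m * n) f))
      t₀<t : t₀ < t
      t₀<t = <-≤-trans (subst (t₀ <_) (+-comm (m * n) n) (+-monoʳ-< (m * n) (second<n m x m<k))) (m≤m+n (suc m * n) f)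
      between : ∀ u → t₀ < u → u < t → plays x (G u) ≡ false
      between u lo hi with u <? suc m * n
      ... | yes u<end = rests-between m x (suc s) n u m<k (subst (_≤ u) (sym (+-suc (m * n) s)) lo)
                          (subst (u <_) (+-comm n (m * n)) u<end) ≤-refl
                          (λ i s<i _ → >⇒≢ (<-trans (first<second m x m<k) s<i) , >⇒≢ s<i)
      ... | no u≮end = rests-between (suc m) x 0 f u sm<k (subst (_≤ u) (sym (+-identityʳ _)) (≮⇒≥ u≮end)) hi
                          (<⇒≤ (first<n (suc m) x sm<k))
                          (λ i _ i<f → <⇒≢ i<f , <⇒≢ (<-trans i<f (first<second (suc m) x sm<k)))
      d+s≡ : d + s ≡ 2k + f
      d+s≡ = cancel d (m * n) s 2k f (idle-after-play x t₀ t (plays-second m x m<k) t₀<t between)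
        where
          -- t = (2k + 1) + m·n + f by the definition of multiplication
          cancel : ∀ d a s K f → d + suc (a + s) ≡ (K + 1 + a) + f → d + s ≡ K + f
          cancel d a s K f e = suc-injective (+-cancelˡ-≡ a _ _ (trans (sym (l d a s)) (trans e (r K a f))))
            where
              l : ∀ d a s → d + suc (a + s) ≡ a + suc (d + s)
              l = solve-∀
              r : ∀ K a f → (K + 1 + a) + f ≡ a + suc (K + f)
              r = solve-∀

  idle-first : ∀ m (x : Fin n) → m < k → IdleAt x (m * n + first m x)
  idle-first zero x _ = idle-round-0 x
  idle-first (suc m) x sm<k = idle-next-round m x sm<k

  idle-at : ∀ t (x : Fin n) → t < N → plays x (G t) ≡ true → IdleAt x t
  idle-at t x t<N p with decompose t
  ... | m , i , i<n , refl with plays-at⇒ m i x (round<k m i t<N) i<n p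
  ...   | inj₁ refl = idle-first m x (round<k m i t<N)
  ...   | inj₂ refl = idle-second m x (round<k m i t<N)

module GamesPlayed (k : ℕ) (k≥1 : 1 ≤ k) where

  open WaleckiSchedule k k≥1

  passed : ℕ → ℕ → ℕ
  passed a i with a <? i
  ... | yes _ = 1
  ... | no _ = 0

  hit : ℕ → ℕ → ℕ
  hit i a with i ≟ a
  ... | yes _ = 1
  ... | no _ = 0

  passed-suc : ∀ a i → passed a (suc i) ≡ passed a i + hit i a
  passed-suc a i with a <? suc i | a <? i | i ≟ a
  ... | yes _ | yes _ | no _ = refl
  ... | yes _ | yes a<i | yes refl = ⊥-elim (<-irrefl refl a<i)
  ... | yes _ | no _ | yes _ = refl
  ... | yes a<1+i | no a≮i | no i≢a = ⊥-elim (i≢a (≤-antisym (≮⇒≥ a≮i) (≤-pred a<1+i)))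
  ... | no a≮1+i | yes a<i | _ = ⊥-elim (a≮1+i (<-trans a<i (n<1+n i)))
  ... | no a≮1+i | no _ | yes refl = ⊥-elim (a≮1+i (n<1+n i))
  ... | no _ | no _ | no _ = refl

  passed-0 : ∀ a i → i ≤ a → passed a i ≡ 0
  passed-0 a i i≤a with a <? i
  ... | yes a<i = ⊥-elim (<⇒≱ a<i i≤a)
  ... | no _ = refl

  passed-1 : ∀ a i → a < i → passed a i ≡ 1
  passed-1 a i a<i with a <? i
  ... | yes _ = refl
  ... | no a≮i = ⊥-elim (a≮i a<i)

  inRound : ℕ → Fin n → ℕ → ℕ
  inRound m x i = passed (first m x) i + passed (second m x) i

  counts-at : ∀ m i (x : Fin n) → m < k → i < n →
              fromBool (plays x (G (m * n + i))) ≡ hit i (first m x) + hit i (second m x)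
  counts-at m i x m<k i<n with i ≟ first m x | i ≟ second m x
  ... | yes e₁ | yes e₂ = ⊥-elim (<⇒≢ (first<second m x m<k) (trans (sym e₁) e₂))
  ... | yes refl | no _ rewrite plays-first m x m<k = refl
  ... | no _ | yes refl rewrite plays-second m x m<k = refl
  ... | no i≢f | no i≢s rewrite rests-at m i x m<k i<n i≢f i≢s = refl

  played-before-round : ∀ m (x : Fin n) → m ≤ k → played x (prefix (m * n)) ≡ m + m
  played-within-round : ∀ m (x : Fin n) i → m < k → i ≤ n → played x (prefix (m * n + i)) ≡ m + m + inRound m x i

  played-before-round zero x _ = refl
  played-before-round (suc m) x sm≤k = begin
      played x (prefix (suc m * n))     ≡⟨ cong (λ t → played x (prefix t)) (+-comm n (m * n)) ⟩
      played x (prefix (m * n + n))     ≡⟨ played-within-round m x n sm≤k ≤-refl ⟩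
      m + m + inRound m x n             ≡⟨ cong (m + m +_) (cong₂ _+_ (passed-1 _ _ (first<n m x sm≤k)) (passed-1 _ _ (second<n m x sm≤k))) ⟩
      m + m + 2                         ≡⟨ two-more m ⟩
      suc m + suc m                     ∎
    where
      open ≡-Reasoning
      two-more : ∀ m → m + m + 2 ≡ suc m + suc m
      two-more = solve-∀

  played-within-round m x zero m<k _ = begin
      played x (prefix (m * n + 0)) ≡⟨ cong (λ t → played x (prefix t)) (+-identityʳ (m * n)) ⟩
      played x (prefix (m * n))     ≡⟨ played-before-round m x (<⇒≤ m<k) ⟩
      m + m                         ≡⟨ sym (+-identityʳ (m + m)) ⟩
      m + m + 0                     ≡⟨ cong (m + m +_) (sym (cong₂ _+_ (passed-0 (first m x) 0 z≤n) (passed-0 (second m x) 0 z≤n))) ⟩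
      m + m + inRound m x 0         ∎
    where open ≡-Reasoning
  played-within-round m x (suc i) m<k 1+i≤n = begin
      played x (prefix (m * n + suc i))   ≡⟨ cong (λ t → played x (prefix t)) (+-suc (m * n) i) ⟩
      played x (prefix (suc (m * n + i))) ≡⟨ played-prefix-suc x (m * n + i) ⟩
      played x (prefix (m * n + i)) + fromBool (plays x (G (m * n + i)))
        ≡⟨ cong₂ _+_ (played-within-round m x i m<k (<⇒≤ 1+i≤n)) (counts-at m i x m<k 1+i≤n) ⟩
      m + m + (passed f i + passed s i) + (hit i f + hit i s)   ≡⟨ regroup (m + m) (passed f i) (passed s i) (hit i f) (hit i s) ⟩
      m + m + ((passed f i + hit i f) + (passed s i + hit i s)) ≡⟨ cong (m + m +_) (sym (cong₂ _+_ (passed-suc f i) (passed-suc s i))) ⟩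
      m + m + inRound m x (suc i)         ∎
    where
      open ≡-Reasoning
      f = first m x
      s = second m x
      regroup : ∀ a b c d e → a + (b + c) + (d + e) ≡ a + ((b + d) + (c + e))
      regroup = solve-∀

  data RoundCount (i : ℕ) : ℕ → Set where
    none : i ≤ k → RoundCount i 0
    one  : RoundCount i 1
    both : k < i → RoundCount i 2

  roundCount : ∀ m (x : Fin n) i → m < k → RoundCount i (inRound m x i)
  roundCount m x i m<k = byCases (first m x <? i) (second m x <? i)
    where
      f = first m x
      s = second m x
      sp = spreadOf m x m<k
      byCases : Dec (f < i) → Dec (s < i) → RoundCount i (inRound m x i)
      byCases (no f≮i) _ rewrite passed-0 f i (≮⇒≥ f≮i) | passed-0 s i (≤-trans (≮⇒≥ f≮i) (<⇒≤ (first<second m x m<k))) =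
        none (≤-trans (≮⇒≥ f≮i) (Spread.first≤k sp))
      byCases (yes f<i) (no s≮i) rewrite passed-1 f i f<i | passed-0 s i (≮⇒≥ s≮i) = one
      byCases (yes f<i) (yes s<i) rewrite passed-1 f i f<i | passed-1 s i s<i =
        both (≤-<-trans (≤-trans (m≤n+m k f) (Spread.gap≥k sp)) s<i)

  roundCount-close : ∀ {i a b} → RoundCount i a → RoundCount i b → ∣ a - b ∣ ≤ 1
  roundCount-close (none _) (none _) = z≤n
  roundCount-close (none _) one = ≤-refl
  roundCount-close (none i≤k) (both k<i) = ⊥-elim (<⇒≱ k<i i≤k)
  roundCount-close one (none _) = ≤-refl
  roundCount-close one one = z≤n
  roundCount-close one (both _) = ≤-refl
  roundCount-close (both k<i) (none i≤k) = ⊥-elim (<⇒≱ k<i i≤k)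
  roundCount-close (both _) one = ≤-refl
  roundCount-close (both _) (both _) = z≤n

  played-close : ∀ l → l ≤ N → ∀ (x y : Fin n) → ∣ played x (prefix l) - played y (prefix l) ∣ ≤ 1
  played-close l l≤N x y with decompose l
  ... | m , i , i<n , refl with m <? k
  ...   | yes m<k rewrite played-within-round m x i m<k (<⇒≤ i<n) | played-within-round m y i m<k (<⇒≤ i<n)
                        | ∣m+n-m+o∣≡∣n-o∣ (m + m) (inRound m x i) (inRound m y i) =
          roundCount-close (roundCount m x i m<k) (roundCount m y i m<k)
  ...   | no m≮k rewrite ≤-antisym l≤N (≤-trans (*-monoˡ-≤ n (≮⇒≥ m≮k)) (m≤m+n (m * n) i))
                       | played-before-round k x ≤-refl | played-before-round k y ≤-refl | ∣n-n∣≡0 (k + k) = z≤n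

module Indices (k : ℕ) (k≥1 : 1 ≤ k) where

  open WaleckiSchedule k k≥1
  open Rests k k≥1
  open GamesPlayed k k≥1

  nearK-close : ∀ {a b} → NearK a → NearK b → ∣ a - b ∣ ≤ 1
  nearK-close {a} {b} (k≤1+a , a≤k) (k≤1+b , b≤k) with ≤-total a b
  ... | inj₁ a≤b rewrite m≤n⇒∣m-n∣≡n∸m a≤b = subst (b ∸ a ≤_) (m+n∸n≡m 1 a) (∸-monoˡ-≤ a (≤-trans b≤k k≤1+a))
  ... | inj₂ b≤a rewrite ∣-∣-comm a b | m≤n⇒∣m-n∣≡n∸m b≤a = subst (a ∸ b ≤_) (m+n∸n≡m 1 b) (∸-monoˡ-≤ b (≤-trans a≤k k≤1+b))

  rest-at-least : RestAtLeast walecki (k ∸ 1)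
  rest-at-least pre g post eq x p earlier with game-in-prefix N pre g post eq
  ... | pre≡ , g≡ , l<N = subst (λ h → k ∸ 1 ≤ idle x h) (sym pre≡) (bound (idle-at l x l<N (subst (λ h → plays x h ≡ true) g≡ p)))
    where
      l = length pre
      -- a first game is impossible, since x has played before
      bound : IdleAt x l → k ∸ 1 ≤ idle x (prefix l)
      bound (first-game _ _ rested) with played-before x l (subst (Any (λ h → plays x h ≡ true)) pre≡ earlier)
      ... | u , u<l , played-u = ⊥-elim (true≢false (trans (sym played-u) (rested u u<l)))
        where true≢false : true ≢ false
              true≢false ()
      bound (later-game _ (k≤1+d , _)) = ∸-monoˡ-≤ 1 k≤1+d

  played-diff : PlayedDiffAtMost walecki 1
  played-diff pre post eq x y =
    subst (λ h → ∣ played x h - played y h ∣ ≤ 1) (sym (prefix-of-prefix N pre post eq))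
      (played-close (length pre) (subst (length pre ≤_) (length-split N pre post eq) (m≤m+n _ _)) x y)

  rest-diff : RestDiffAtMost walecki 1
  rest-diff pre i j post eq with game-in-prefix N pre (i , j) post eq
  ... | pre≡ , g≡ , l<N = subst (λ h → ∣ idle i h - idle j h ∣ ≤ 1) (sym pre≡) (close (idle-at l i l<N i-plays) (idle-at l j l<N j-plays))
    where
      l = length pre
      i-plays = subst (λ h → plays i h ≡ true) g≡ (plays-fst i j)
      j-plays = subst (λ h → plays j h ≡ true) g≡ (plays-snd i j)
      -- first games only happen before time k, later games from time k on
      close : IdleAt i l → IdleAt j l → ∣ idle i (prefix l) - idle j (prefix l) ∣ ≤ 1
      close (first-game _ di _) (first-game _ dj _) rewrite di | dj | ∣n-n∣≡0 l = z≤n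
      close (first-game l<k _ _) (later-game k≤l _) = ⊥-elim (<⇒≱ l<k k≤l)
      close (later-game k≤l _) (first-game l<k _ _) = ⊥-elim (<⇒≱ l<k k≤l)
      close (later-game _ near-i) (later-game _ near-j) = nearK-close near-i near-j

  -- The opening of the schedule: team ∞ plays at times 0 and k, and team k
  -- plays its first game at time k, against ∞.
  team∞ teamK : Fin n
  team∞ = team 2k
  teamK = team k

  k<n : k < n
  k<n = <-trans k<2k 2k<n

  k<N : k < N
  k<N = <-≤-trans k<n (subst (_≤ N) (+-identityʳ n) (*-monoˡ-≤ n k≥1))

  G-k : G k ≡ (teamK , team∞)
  G-k = trans (G-at 0 k k<n) (trans (cong game (roundGame-k 0)) (game-< k<2k))

  positions-team∞ : positions 0 (toℕ team∞) ≡ (0 , k)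
  positions-team∞ = trans (cong (positions 0) (toℕ-team 2k<n)) (positions-∞ 0)

  positions-teamK : positions 0 (toℕ teamK) ≡ (k , k + k)
  positions-teamK = trans (cong (positions 0) (toℕ-team k<n)) (positions-up 0 k k≥1 k≥1 ≤-refl)

  team∞-plays-0 : plays team∞ (G 0) ≡ true
  team∞-plays-0 = subst (λ i → plays team∞ (G i) ≡ true) (cong proj₁ positions-team∞) (plays-first 0 team∞ k≥1)

  team∞-plays-k : plays team∞ (G k) ≡ true
  team∞-plays-k = subst (λ i → plays team∞ (G i) ≡ true) (cong proj₂ positions-team∞) (plays-second 0 team∞ k≥1)

  teamK-rests : ∀ u → u < k → plays teamK (G u) ≡ false
  teamK-rests u u<k = rests-between 0 teamK 0 k u k≥1 z≤n u<k (<⇒≤ k<n)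
    (λ i _ i<k → (λ e → <⇒≢ i<k (trans e (cong proj₁ positions-teamK))) ,
                 (λ e → <⇒≢ (<-≤-trans i<k (m≤m+n k k)) (trans e (cong proj₂ positions-teamK))))

  idle-team∞ : idle team∞ (prefix k) ≡ k ∸ 1
  idle-team∞ = trans (sym (m+n∸n≡m _ 1)) (cong (_∸ 1) (idle-after-play team∞ 0 k team∞-plays-0 k≥1 rests))
    where
      rests : ∀ u → 0 < u → u < k → plays team∞ (G u) ≡ false
      rests u 0<u u<k = rests-between 0 team∞ 1 k u k≥1 0<u u<k (<⇒≤ k<n)
        (λ i 0<i i<k → (λ e → >⇒≢ 0<i (trans e (cong proj₁ positions-team∞))) ,
                       (λ e → <⇒≢ i<k (trans e (cong proj₂ positions-team∞))))

  idle-teamK : idle teamK (prefix k) ≡ k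
  idle-teamK = idle-without-play teamK k teamK-rests

  -- ∞ only rests k−1 games between its first two games.
  rest-sharp : ¬ RestAtLeast walecki (suc (k ∸ 1))
  rest-sharp rest = <-irrefl refl (subst (suc (k ∸ 1) ≤_) idle-team∞
    (rest (prefix k) (G k) _ (prefix-at N k k<N) team∞ team∞-plays-k (lose (∈-prefix 0 k k≥1) team∞-plays-0)))

  -- After the first game ∞ has played once and team k not at all.
  played-sharp : ∀ q → PlayedDiffAtMost walecki q → 1 ≤ q
  played-sharp q diff = subst (_≤ q) after-one (diff (prefix 1) (segment 1 (N ∸ 1)) split team∞ teamK)
    where
      split : prefix N ≡ prefix 1 ++ segment 1 (N ∸ 1)
      split = trans (cong prefix (sym (m+[n∸m]≡n (≤-trans k≥1 (<⇒≤ k<N))))) (prefix-+ 1 (N ∸ 1))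
      after-one : ∣ played team∞ (prefix 1) - played teamK (prefix 1) ∣ ≡ 1
      after-one = cong₂ ∣_-_∣ (trans (played-prefix-suc team∞ 0) (cong fromBool team∞-plays-0))
                              (trans (played-prefix-suc teamK 0) (cong fromBool (teamK-rests 0 k≥1)))

  -- In game k team k has rested k games and ∞ only k−1.
  rest-diff-sharp : ∀ e → RestDiffAtMost walecki e → 1 ≤ e
  rest-diff-sharp e diff = subst (_≤ e) idle-gap
    (diff (prefix k) teamK team∞ (segment (suc k) (N ∸ suc k)) (trans (prefix-at N k k<N) (cong (λ g → prefix k ++ g ∷ segment (suc k) (N ∸ suc k)) G-k)))
    where
      idle-gap : ∣ idle teamK (prefix k) - idle team∞ (prefix k) ∣ ≡ 1
      idle-gap = begin
        ∣ idle teamK (prefix k) - idle team∞ (prefix k) ∣ ≡⟨ cong₂ ∣_-_∣ idle-teamK idle-team∞ ⟩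
        ∣ k - (k ∸ 1) ∣                                   ≡⟨ m≤n⇒∣n-m∣≡n∸m (m∸n≤m k 1) ⟩
        k ∸ (k ∸ 1)                                       ≡⟨ m∸[m∸n]≡n k≥1 ⟩
        1                                                 ∎
        where open ≡-Reasoning

module RoundRobin (k : ℕ) (k≥1 : 1 ≤ k) where

  open WaleckiSchedule k k≥1

  k<n : k < n
  k<n = <-trans k<2k 2k<n

  behind<2k : ∀ m j → m < k → j ≤ k → m ⊖ j < 2k
  behind<2k m j m<k j≤k = ⊖<2k m j (<-trans m<k k<2k) (≤-trans j≤k (<⇒≤ k<2k))

  half : ℕ → ℕ
  half zero = zero
  half (suc zero) = zero
  half (suc (suc d)) = suc (half d)

  isOdd : ℕ → Bool
  isOdd zero = false
  isOdd (suc zero) = true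
  isOdd (suc (suc d)) = isOdd d

  half-even : ∀ c → half (c + c) ≡ c
  half-even zero = refl
  half-even (suc c) rewrite +-suc c c = cong suc (half-even c)

  half-odd : ∀ c → half (suc (c + c)) ≡ c
  half-odd zero = refl
  half-odd (suc c) rewrite +-suc c c = cong suc (half-odd c)

  isOdd-even : ∀ c → isOdd (c + c) ≡ false
  isOdd-even zero = refl
  isOdd-even (suc c) rewrite +-suc c c = isOdd-even c

  isOdd-odd : ∀ c → isOdd (suc (c + c)) ≡ true
  isOdd-odd zero = refl
  isOdd-odd (suc c) rewrite +-suc c c = isOdd-odd c

  even-or-odd : ∀ d → d ≡ half d + half d ⊎ d ≡ suc (half d + half d)
  even-or-odd zero = inj₁ refl
  even-or-odd (suc zero) = inj₂ refl
  even-or-odd (suc (suc d)) with even-or-odd d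
  ... | inj₁ e = inj₁ (cong suc (trans (cong suc e) (sym (+-suc (half d) (half d)))))
  ... | inj₂ e = inj₂ (cong suc (cong suc (trans e (sym (+-suc (half d) (half d))))))

  double<⇒< : ∀ a b → a + a < b + b → a < b
  double<⇒< a b lt = ≰⇒> λ b≤a → <⇒≱ lt (+-mono-≤ b≤a b≤a)

  -- The time at which teams x < y meet: ∞ meets x in round x (position 0)
  -- or in round x − k (position k); teams at distance 2c meet in round x + c
  -- (position c) or x + c − k (position k − c); teams at distance 2c + 1 in
  -- round x + c (position k + c + 1) or x + c − k (position 2k − c).
  time∞ : ℕ → ℕ
  time∞ x with x <? k
  ... | yes _ = x * n
  ... | no _ = (x ∸ k) * n + k

  timeEven : ℕ → ℕ → ℕ
  timeEven x c with x + c <? k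
  ... | yes _ = (x + c) * n + c
  ... | no _ = (x + c ∸ k) * n + (k ∸ c)

  timeOdd : ℕ → ℕ → ℕ
  timeOdd x c with x + c <? k
  ... | yes _ = (x + c) * n + (k + suc c)
  ... | no _ = (x + c ∸ k) * n + (2k ∸ c)

  timeFinite : ℕ → ℕ → ℕ
  timeFinite x d with isOdd d
  ... | true = timeOdd x (half d)
  ... | false = timeEven x (half d)

  meetingTime : ℕ → ℕ → ℕ
  meetingTime x y with y ≟ 2k
  ... | yes _ = time∞ x
  ... | no _ = timeFinite x (y ∸ x)

  meetingTime-∞ : ∀ x → meetingTime x 2k ≡ time∞ x
  meetingTime-∞ x with 2k ≟ 2k
  ... | yes _ = refl
  ... | no 2k≢2k = ⊥-elim (2k≢2k refl)

  meetingTime-even : ∀ x y c → y ≢ 2k → y ≡ x + (c + c) → meetingTime x y ≡ timeEven x c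
  meetingTime-even x y c y≢2k refl with x + (c + c) ≟ 2k
  ... | yes y≡2k = ⊥-elim (y≢2k y≡2k)
  ... | no _ rewrite m+n∸m≡n x (c + c) | isOdd-even c | half-even c = refl

  meetingTime-odd : ∀ x y c → y ≢ 2k → y ≡ x + suc (c + c) → meetingTime x y ≡ timeOdd x c
  meetingTime-odd x y c y≢2k refl with x + suc (c + c) ≟ 2k
  ... | yes y≡2k = ⊥-elim (y≢2k y≡2k)
  ... | no _ rewrite m+n∸m≡n x (suc (c + c)) | isOdd-odd c | half-odd c = refl

  time∞-< : ∀ x → x < k → time∞ x ≡ x * n
  time∞-< x x<k with x <? k
  ... | yes _ = refl
  ... | no x≮k = ⊥-elim (x≮k x<k)

  time∞-≥ : ∀ x → k ≤ x → time∞ x ≡ (x ∸ k) * n + k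
  time∞-≥ x k≤x with x <? k
  ... | yes x<k = ⊥-elim (<⇒≱ x<k k≤x)
  ... | no _ = refl

  timeEven-< : ∀ x c → x + c < k → timeEven x c ≡ (x + c) * n + c
  timeEven-< x c lt with x + c <? k
  ... | yes _ = refl
  ... | no ¬lt = ⊥-elim (¬lt lt)

  timeEven-≥ : ∀ x c → k ≤ x + c → timeEven x c ≡ (x + c ∸ k) * n + (k ∸ c)
  timeEven-≥ x c ge with x + c <? k
  ... | yes lt = ⊥-elim (<⇒≱ lt ge)
  ... | no _ = refl

  timeOdd-< : ∀ x c → x + c < k → timeOdd x c ≡ (x + c) * n + (k + suc c)
  timeOdd-< x c lt with x + c <? k
  ... | yes _ = refl
  ... | no ¬lt = ⊥-elim (¬lt lt)

  timeOdd-≥ : ∀ x c → k ≤ x + c → timeOdd x c ≡ (x + c ∸ k) * n + (2k ∸ c)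
  timeOdd-≥ x c ge with x + c <? k
  ... | yes lt = ⊥-elim (<⇒≱ lt ge)
  ... | no _ = refl

  timeOfGame : Game n → ℕ
  timeOfGame g = meetingTime (toℕ (proj₁ g)) (toℕ (proj₂ g))

  timeOfGame-< : ∀ {a b} → a < b → b < n → timeOfGame (game (a , b)) ≡ meetingTime a b
  timeOfGame-< a<b b<n rewrite game-< a<b | toℕ-team (<-trans a<b b<n) | toℕ-team b<n = refl

  timeOfGame-> : ∀ {a b} → b < a → a < n → timeOfGame (game (a , b)) ≡ meetingTime b a
  timeOfGame-> b<a a<n rewrite game-> b<a | toℕ-team a<n | toℕ-team (<-trans b<a a<n) = refl

  decode-first : ∀ m → m < k → timeOfGame (game (2k , m)) ≡ m * n + 0
  decode-first m m<k = begin
      timeOfGame (game (2k , m)) ≡⟨ timeOfGame-> (<-trans m<k k<2k) 2k<n ⟩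
      meetingTime m 2k           ≡⟨ meetingTime-∞ m ⟩
      time∞ m                    ≡⟨ time∞-< m m<k ⟩
      m * n                      ≡⟨ sym (+-identityʳ _) ⟩
      m * n + 0                  ∎
    where open ≡-Reasoning

  decode-kth : ∀ m → m < k → timeOfGame (game (m + k , 2k)) ≡ m * n + k
  decode-kth m m<k = begin
      timeOfGame (game (m + k , 2k)) ≡⟨ timeOfGame-< (m+e<2k m k m<k ≤-refl) 2k<n ⟩
      meetingTime (m + k) 2k         ≡⟨ meetingTime-∞ (m + k) ⟩
      time∞ (m + k)                  ≡⟨ time∞-≥ (m + k) (m≤n+m k m) ⟩
      (m + k ∸ k) * n + k            ≡⟨ cong (λ r → r * n + k) (m+n∸n≡m m k) ⟩
      m * n + k                      ∎
    where open ≡-Reasoning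

  -- Game i of round m pairs b = m ⊖ i with b + 2i = m + i (no wrap-around), or
  -- m + i with m + i + 2(k − i) = m ⊖ i (wrap-around).
  decode-middle : ∀ m i → m < k → 1 ≤ i → i < k → timeOfGame (game (m + i , m ⊖ i)) ≡ m * n + i
  decode-middle m i m<k 1≤i i<k = byCase (i ≤? m)
    where
      open ≡-Reasoning
      b = m ⊖ i
      m+i<2k = m+e<2k m i m<k (<⇒≤ i<k)
      b<2k = behind<2k m i m<k (<⇒≤ i<k)
      byCase : Dec (i ≤ m) → timeOfGame (game (m + i , b)) ≡ m * n + i
      byCase (yes i≤m) = begin
          timeOfGame (game (m + i , b)) ≡⟨ timeOfGame-> b<m+i (<2k⇒<n m+i<2k) ⟩
          meetingTime b (m + i)         ≡⟨ meetingTime-even b (m + i) i (<⇒≢ m+i<2k) m+i≡ ⟩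
          timeEven b i                  ≡⟨ timeEven-< b i (subst (_< k) (sym b+i≡m) m<k) ⟩
          (b + i) * n + i               ≡⟨ cong (λ r → r * n + i) b+i≡m ⟩
          m * n + i                     ∎
        where
          b+i≡m : b + i ≡ m
          b+i≡m = ⊖-no-wrap m i i≤m
          b<m+i : b < m + i
          b<m+i = <-≤-trans (subst (b <_) b+i≡m (m<m+n b 1≤i)) (m≤m+n m i)
          m+i≡ : m + i ≡ b + (i + i)
          m+i≡ = trans (cong (_+ i) (sym b+i≡m)) (+-assoc b i i)
      byCase (no i≰m) = begin
          timeOfGame (game (m + i , b))  ≡⟨ timeOfGame-< m+i<b (<2k⇒<n b<2k) ⟩
          meetingTime (m + i) b          ≡⟨ meetingTime-even (m + i) b c (<⇒≢ b<2k) b≡ ⟩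
          timeEven (m + i) c             ≡⟨ timeEven-≥ (m + i) c (subst (k ≤_) (sym m+i+c≡m+k) (m≤n+m k m)) ⟩
          (m + i + c ∸ k) * n + (k ∸ c)  ≡⟨ cong₂ (λ r p → r * n + p) (trans (cong (_∸ k) m+i+c≡m+k) (m+n∸n≡m m k)) (m∸[m∸n]≡n (<⇒≤ i<k)) ⟩
          m * n + i                      ∎
        where
          c = k ∸ i
          b+i≡ : b + i ≡ m + 2k
          b+i≡ = ⊖-wrap m i (≰⇒> i≰m) (≤-trans (<⇒≤ (<-trans i<k k<2k)) (m≤n+m 2k m))
          c+i≡k : c + i ≡ k
          c+i≡k = m∸n+n≡m (<⇒≤ i<k)
          m+i+c≡m+k : m + i + c ≡ m + k
          m+i+c≡m+k = trans (+-assoc m i c) (cong (m +_) (trans (+-comm i c) c+i≡k))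
          b≡ : b ≡ m + i + (c + c)
          b≡ = +-cancelʳ-≡ i b _ (begin
              b + i                     ≡⟨ b+i≡ ⟩
              m + 2k                    ≡⟨ cong (m +_) 2k≡k+k ⟩
              m + (k + k)               ≡⟨ sym (+-assoc m k k) ⟩
              m + k + k                 ≡⟨ cong (λ r → m + r + r) (sym c+i≡k) ⟩
              m + (c + i) + (c + i)     ≡⟨ regroup m c i ⟩
              m + i + (c + c) + i       ∎)
            where regroup : ∀ m c i → m + (c + i) + (c + i) ≡ m + i + (c + c) + i
                  regroup = solve-∀
          m+i<b : m + i < b
          m+i<b = +-cancelʳ-< i (m + i) b (subst (m + i + i <_) (sym b+i≡)
                    (subst (_< m + 2k) (sym (+-assoc m i i)) (+-monoʳ-< m (subst (i + i <_) (sym 2k≡k+k) (+-mono-< i<k i<k)))))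

  -- Game k + j + 1 of round m pairs b = m ⊖ j with b + 2j + 1 = m + j + 1 (no
  -- wrap-around), or m + j + 1 with m + j + 1 + 2(k − j − 1) + 1 = b.
  decode-late : ∀ m j → m < k → suc j ≤ k → timeOfGame (game (m ⊖ j , m + suc j)) ≡ m * n + (k + suc j)
  decode-late m j m<k sj≤k = byCase (j ≤? m)
    where
      open ≡-Reasoning
      b = m ⊖ j
      a = m + suc j
      a<2k = m+e<2k m (suc j) m<k sj≤k
      b<2k = behind<2k m j m<k (≤-trans (n≤1+n j) sj≤k)
      byCase : Dec (j ≤ m) → timeOfGame (game (b , a)) ≡ m * n + (k + suc j)
      byCase (yes j≤m) = begin
          timeOfGame (game (b , a))   ≡⟨ timeOfGame-< b<a (<2k⇒<n a<2k) ⟩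
          meetingTime b a             ≡⟨ meetingTime-odd b a j (<⇒≢ a<2k) a≡ ⟩
          timeOdd b j                 ≡⟨ timeOdd-< b j (subst (_< k) (sym b+j≡m) m<k) ⟩
          (b + j) * n + (k + suc j)   ≡⟨ cong (λ r → r * n + (k + suc j)) b+j≡m ⟩
          m * n + (k + suc j)         ∎
        where
          b+j≡m : b + j ≡ m
          b+j≡m = ⊖-no-wrap m j j≤m
          b<a : b < a
          b<a = ≤-trans (s≤s (subst (b ≤_) b+j≡m (m≤m+n b j))) (subst (suc m ≤_) (sym (+-suc m j)) (s≤s (m≤m+n m j)))
          a≡ : a ≡ b + suc (j + j)
          a≡ = trans (cong (_+ suc j) (sym b+j≡m)) (trans (+-assoc b j (suc j)) (cong (b +_) (+-suc j j)))
      byCase (no j≰m) = begin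
          timeOfGame (game (b , a))      ≡⟨ timeOfGame-> a<b (<2k⇒<n b<2k) ⟩
          meetingTime a b                ≡⟨ meetingTime-odd a b c (<⇒≢ b<2k) b≡ ⟩
          timeOdd a c                    ≡⟨ timeOdd-≥ a c (subst (k ≤_) (sym a+c≡m+k) (m≤n+m k m)) ⟩
          (a + c ∸ k) * n + (2k ∸ c)     ≡⟨ cong₂ (λ r p → r * n + p) (trans (cong (_∸ k) a+c≡m+k) (m+n∸n≡m m k)) 2k∸c≡ ⟩
          m * n + (k + suc j)            ∎
        where
          c = k ∸ suc j
          b+j≡ : b + j ≡ m + 2k
          b+j≡ = ⊖-wrap m j (≰⇒> j≰m) (≤-trans (<⇒≤ (<-trans sj≤k k<2k)) (m≤n+m 2k m))
          c+sj≡k : c + suc j ≡ k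
          c+sj≡k = m∸n+n≡m sj≤k
          a+c≡m+k : a + c ≡ m + k
          a+c≡m+k = trans (+-assoc m (suc j) c) (cong (m +_) (trans (+-comm (suc j) c) c+sj≡k))
          2k∸c≡ : 2k ∸ c ≡ k + suc j
          2k∸c≡ = trans (cong (_∸ c) 2k≡k+k) (trans (+-∸-assoc k (m∸n≤m k (suc j))) (cong (k +_) (m∸[m∸n]≡n sj≤k)))
          b≡ : b ≡ a + suc (c + c)
          b≡ = +-cancelʳ-≡ j b _ (begin
              b + j                         ≡⟨ b+j≡ ⟩
              m + 2k                        ≡⟨ cong (m +_) 2k≡k+k ⟩
              m + (k + k)                   ≡⟨ sym (+-assoc m k k) ⟩
              m + k + k                     ≡⟨ cong (λ r → m + r + r) (sym c+sj≡k) ⟩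
              m + (c + suc j) + (c + suc j) ≡⟨ regroup m c j ⟩
              m + suc j + suc (c + c) + j   ∎)
            where regroup : ∀ m c j → m + (c + suc j) + (c + suc j) ≡ m + suc j + suc (c + c) + j
                  regroup = solve-∀
          a<b : a < b
          a<b = +-cancelʳ-< j a b (subst (a + j <_) (sym b+j≡)
                  (subst (_< m + 2k) (sym (+-assoc m (suc j) j)) (+-monoʳ-< m (subst (suc j + j <_) (sym 2k≡k+k) (+-mono-≤-< sj≤k sj≤k)))))

  decode : ∀ m i → m < k → i < n → timeOfGame (G (m * n + i)) ≡ m * n + i
  decode m i m<k i<n rewrite G-at m i i<n with positionView i i<n
  ... | first-game rewrite roundGame-0 m = decode-first m m<k
  ... | middle-game i 1≤i i<k rewrite roundGame-mid m i 1≤i i<k = decode-middle m i m<k 1≤i i<k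
  ... | kth-game rewrite roundGame-k m = decode-kth m m<k
  ... | late-game (suc j) _ sj≤k rewrite roundGame-late m (suc j) (s≤s z≤n) = decode-late m j m<k sj≤k

  G-injective : ∀ u v → u < N → v < N → G u ≡ G v → u ≡ v
  G-injective u v u<N v<N Gu≡Gv with decompose u | decompose v
  ... | m , i , i<n , refl | m′ , i′ , i′<n , refl =
        trans (sym (decode m i (round<k m i u<N) i<n)) (trans (cong timeOfGame Gu≡Gv) (decode m′ i′ (round<k m′ i′ v<N) i′<n))

  Meets : ℕ → ℕ → Set
  Meets x y = Σ ℕ λ m → Σ ℕ λ i → m < k × i < n × (roundGame m i ≡ (x , y) ⊎ roundGame m i ≡ (y , x))

  meets-∞ : ∀ x → x < 2k → Meets x 2k
  meets-∞ x x<2k with x <? k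
  ... | yes x<k = x , 0 , x<k , ≤-<-trans z≤n 2k<n , inj₂ (roundGame-0 x)
  ... | no x≮k = x ∸ k , k , x∸k<k , k<n , inj₁ (trans (roundGame-k (x ∸ k)) (cong (_, 2k) (m∸n+n≡m (≮⇒≥ x≮k))))
    where
      x∸k<k : x ∸ k < k
      x∸k<k = +-cancelʳ-< k (x ∸ k) k (subst₂ _<_ (sym (m∸n+n≡m (≮⇒≥ x≮k))) 2k≡k+k x<2k)

  -- x and x + 2c meet in round x + c at position c, or in round x + c − k
  -- at position k − c.
  meets-even : ∀ x c → 1 ≤ c → x + (c + c) < 2k → Meets x (x + (c + c))
  meets-even x c 1≤c y<2k with x + c <? k
  ... | yes x+c<k = x + c , c , x+c<k , <-trans c<k k<n ,
                    inj₂ (trans (roundGame-mid (x + c) c 1≤c c<k) (cong₂ _,_ (+-assoc x c c) (⊖-unwrapped {x + c} {c} {x} refl)))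
    where c<k = ≤-<-trans (m≤n+m c x) x+c<k
  ... | no x+c≮k = m , i , m<k , <-trans i<k k<n , inj₁ (trans (roundGame-mid m i 1≤i i<k) (cong₂ _,_ m+i≡x m⊖i≡y))
    where
      m = x + c ∸ k
      i = k ∸ c
      m+k≡x+c : m + k ≡ x + c
      m+k≡x+c = m∸n+n≡m (≮⇒≥ x+c≮k)
      x+c+c<k+k : x + c + c < k + k
      x+c+c<k+k = subst₂ _<_ (sym (+-assoc x c c)) 2k≡k+k y<2k
      c<k : c < k
      c<k = double<⇒< c k (≤-<-trans (m≤n+m (c + c) x) (subst (_< k + k) (+-assoc x c c) x+c+c<k+k))
      i+c≡k : i + c ≡ k
      i+c≡k = m∸n+n≡m (<⇒≤ c<k)
      m<k : m < k
      m<k = +-cancelʳ-< k m k (subst (_< k + k) (sym m+k≡x+c) (≤-<-trans (m≤m+n (x + c) c) x+c+c<k+k))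
      1≤i : 1 ≤ i
      1≤i = m<n⇒0<n∸m c<k
      i<k : i < k
      i<k = subst (i <_) i+c≡k (m<m+n i 1≤c)
      -- all remaining facts follow from m + k = x + c and i + c = k
      m+i≡x : m + i ≡ x
      m+i≡x = +-cancelʳ-≡ k (m + i) x (begin
          m + i + k       ≡⟨ cong (λ r → m + i + r) (sym i+c≡k) ⟩
          m + i + (i + c) ≡⟨ shuffle m i c ⟩
          m + (i + c) + i ≡⟨ cong (λ r → m + r + i) i+c≡k ⟩
          m + k + i       ≡⟨ cong (_+ i) m+k≡x+c ⟩
          x + c + i       ≡⟨ +-assoc x c i ⟩
          x + (c + i)     ≡⟨ cong (x +_) (trans (+-comm c i) i+c≡k) ⟩
          x + k           ∎)
        where open ≡-Reasoning
              shuffle : ∀ m i c → m + i + (i + c) ≡ m + (i + c) + i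
              shuffle = solve-∀
      m<i : m < i
      m<i = +-cancelʳ-< (c + k) m i (subst₂ _<_
              (trans (cong (_+ c) (sym m+k≡x+c)) (trans (+-assoc m k c) (cong (m +_) (+-comm k c))))
              (trans (cong (_+ k) (sym i+c≡k)) (+-assoc i c k)) x+c+c<k+k)
      m⊖i≡y : m ⊖ i ≡ x + (c + c)
      m⊖i≡y = ⊖-wrapped m<i (begin
          x + (c + c) + i ≡⟨ shuffle x c i ⟩
          x + c + (i + c) ≡⟨ cong₂ _+_ (sym m+k≡x+c) i+c≡k ⟩
          m + k + k       ≡⟨ +-assoc m k k ⟩
          m + (k + k)     ≡⟨ cong (m +_) (sym 2k≡k+k) ⟩
          m + 2k          ∎)
        where open ≡-Reasoning
              shuffle : ∀ x c i → x + (c + c) + i ≡ x + c + (i + c)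
              shuffle = solve-∀

  -- x and x + 2c + 1 meet in round x + c at position k + c + 1, or in round
  -- x + c − k at position k + j + 1 where j + c + 1 = k.
  meets-odd : ∀ x c → x + suc (c + c) < 2k → Meets x (x + suc (c + c))
  meets-odd x c y<2k with x + c <? k
  ... | yes x+c<k = x + c , k + suc c , x+c<k , late<n c<k ,
                    inj₁ (trans (roundGame-late (x + c) (suc c) (s≤s z≤n))
                                (cong₂ _,_ (⊖-unwrapped {x + c} {c} {x} refl) (trans (+-assoc x c (suc c)) (cong (x +_) (+-suc c c)))))
    where
      c<k = ≤-<-trans (m≤n+m c x) x+c<k
      late<n : ∀ {j} → j < k → k + suc j < n
      late<n {j} j<k = ≤-<-trans (subst (k + suc j ≤_) (sym 2k≡k+k) (+-monoʳ-≤ k j<k)) 2k<n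
  ... | no x+c≮k = m , k + suc j , m<k , late<n , inj₂ (trans (roundGame-late m (suc j) (s≤s z≤n)) (cong₂ _,_ m⊖j≡y m+sj≡x))
    where
      m = x + c ∸ k
      j = k ∸ suc c
      m+k≡x+c : m + k ≡ x + c
      m+k≡x+c = m∸n+n≡m (≮⇒≥ x+c≮k)
      x+c+sc<k+k : x + c + suc c < k + k
      x+c+sc<k+k = subst₂ _<_ (sym (trans (+-assoc x c (suc c)) (cong (x +_) (+-suc c c)))) 2k≡k+k y<2k
      c<k : c < k
      c<k = double<⇒< c k (≤-<-trans (≤-trans (n≤1+n (c + c)) (m≤n+m (suc (c + c)) x)) (subst (x + suc (c + c) <_) 2k≡k+k y<2k))
      j+sc≡k : j + suc c ≡ k
      j+sc≡k = m∸n+n≡m c<k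
      late<n : k + suc j < n
      late<n = ≤-<-trans (subst (k + suc j ≤_) (sym 2k≡k+k) (+-monoʳ-≤ k (subst (suc j ≤_) j+sc≡k (≤-trans (s≤s (m≤m+n j c)) (≤-reflexive (sym (+-suc j c))))))) 2k<n
      m<k : m < k
      m<k = +-cancelʳ-< k m k (subst (_< k + k) (sym m+k≡x+c) (≤-<-trans (m≤m+n (x + c) (suc c)) x+c+sc<k+k))
      -- all remaining facts follow from m + k = x + c and j + c + 1 = k
      m+sj≡x : m + suc j ≡ x
      m+sj≡x = +-cancelʳ-≡ c (m + suc j) x (begin
          m + suc j + c   ≡⟨ shuffle m j c ⟩
          m + (j + suc c) ≡⟨ cong (m +_) j+sc≡k ⟩
          m + k           ≡⟨ m+k≡x+c ⟩
          x + c           ∎)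
        where open ≡-Reasoning
              shuffle : ∀ m j c → m + suc j + c ≡ m + (j + suc c)
              shuffle = solve-∀
      m<j : m < j
      m<j = +-cancelʳ-< (suc c + k) m j (subst₂ _<_
              (trans (cong (_+ suc c) (sym m+k≡x+c)) (trans (+-assoc m k (suc c)) (cong (m +_) (+-comm k (suc c)))))
              (trans (cong (_+ k) (sym j+sc≡k)) (+-assoc j (suc c) k)) x+c+sc<k+k)
      m⊖j≡y : m ⊖ j ≡ x + suc (c + c)
      m⊖j≡y = ⊖-wrapped m<j (begin
          x + suc (c + c) + j ≡⟨ shuffle x c j ⟩
          x + c + (j + suc c) ≡⟨ cong₂ _+_ (sym m+k≡x+c) j+sc≡k ⟩
          m + k + k           ≡⟨ +-assoc m k k ⟩
          m + (k + k)         ≡⟨ cong (m +_) (sym 2k≡k+k) ⟩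
          m + 2k              ∎)
        where open ≡-Reasoning
              shuffle : ∀ x c j → x + suc (c + c) + j ≡ x + c + (j + suc c)
              shuffle = solve-∀

  meets : ∀ x y → x < y → y < n → Meets x y
  meets x y x<y y<n with y ≟ 2k
  ... | yes refl = meets-∞ x x<y
  ... | no y≢2k = byParity (even-or-odd (y ∸ x))
    where
      y<2k = ≤∧≢⇒< (<n⇒≤2k y<n) y≢2k
      c = half (y ∸ x)
      x+d≡y : x + (y ∸ x) ≡ y
      x+d≡y = m+[n∸m]≡n (<⇒≤ x<y)
      byParity : (y ∸ x ≡ c + c) ⊎ (y ∸ x ≡ suc (c + c)) → Meets x y
      byParity (inj₁ d≡2c) = subst (Meets x) y≡ (meets-even x c 1≤c (subst (_< 2k) (sym y≡) y<2k))
        where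
          y≡ : x + (c + c) ≡ y
          y≡ = trans (cong (x +_) (sym d≡2c)) x+d≡y
          1≤c : 1 ≤ c
          1≤c = n≢0⇒n>0 λ c≡0 → <⇒≢ x<y (trans (sym (+-identityʳ x)) (trans (cong (λ c → x + (c + c)) (sym c≡0)) y≡))
      byParity (inj₂ d≡2c+1) = subst (Meets x) y≡ (meets-odd x c (subst (_< 2k) (sym y≡) y<2k))
        where
          y≡ : x + suc (c + c) ≡ y
          y≡ = trans (cong (x +_) (sym d≡2c+1)) x+d≡y

  round-robin : IsRoundRobin n walecki
  round-robin = ordered , Unique-prefix N G-injective , complete
    where
      ordered : All (λ g → proj₁ g Fin.< proj₂ g) walecki
      ordered = All-prefix N λ u u<N → ordered-at u u<N
        where
          ordered-at : ∀ u → u < N → proj₁ (G u) Fin.< proj₂ (G u)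
          ordered-at u u<N with decompose u
          ... | m , i , i<n , refl with roundGame-valid m i (round<k m i u<N) i<n
          ...   | a<n , b<n , a≢b rewrite G-at m i i<n = game-ordered a<n b<n a≢b
      complete : ∀ (a b : Fin n) → a Fin.< b → (a , b) ∈ walecki
      complete a b a<b with meets (toℕ a) (toℕ b) a<b (toℕ<n b)
      ... | m , i , m<k , i<n , pair = subst (_∈ walecki) G≡ (∈-prefix (m * n + i) N (time<N m i m<k i<n))
        where
          G≡ : G (m * n + i) ≡ (a , b)
          G≡ = trans (G-at m i i<n) (trans (byOrder pair) (cong₂ _,_ (team-toℕ a) (team-toℕ b)))
            where
              byOrder : (roundGame m i ≡ (toℕ a , toℕ b) ⊎ roundGame m i ≡ (toℕ b , toℕ a)) →
                        game (roundGame m i) ≡ (team (toℕ a) , team (toℕ b))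
              byOrder (inj₁ e) = trans (cong game e) (game-< a<b)
              byOrder (inj₂ e) = trans (cong game e) (game-> a<b)

theorem4p4 : ∀ (k : ℕ) → 1 ≤ k →
    Σ (Schedule (2 * k + 1)) λ S →
    IsRoundRobin (2 * k + 1) S × GuaranteedRestTime S (k ∸ 1) ×
    GamesPlayedDiffIndex S 1 × RestDiffIndex S 1
theorem4p4 k k≥1 =
    walecki , round-robin ,
    (rest-at-least , rest-sharp) , (played-diff , played-sharp) , (rest-diff , rest-diff-sharp)
  where
    open WaleckiSchedule k k≥1
    open Indices k k≥1
    open RoundRobin k k≥1
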